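{- Let $q\ge 2$ and $n\ge 1$ be integers and $Q=\{0,\dots,q-1\}$. For every integer $k$ with $1\le k\le q^n$, there exists an automata network $F:Q^n\to Q^n$ with almost degree $1$ whose longest limit cycle has length exactly $k$.
   Context: An automata network is a map $F:Q^V\to Q^V$, $V=\{1,\dots,n\}$, with local functions $f_j(x)=F(x)_j$. Its interaction graph has an arc $(i,j)$ iff $f_j$ effectively depends on $x_i$ (there exist $x,x'$ differing only at $i$ with $f_j(x)\neq f_j(x')$). $F$ has almost degree $1$ if all but at most one node of its interaction graph have in-degree at most $1$. A limit cycle of $F$ is a cycle in the functional graph $x\mapsto F(x)$ on $Q^n$ (a periodic orbit), and its length is its number of configurations. -}

module Defs where

open import Data.Nat using (ℕ; zero; suc; _≤_; _<_)
open import Data.Fin using (Fin; _≟_)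
open import Data.Product using (Σ; ∃; _×_)
open import Data.Sum using (_⊎_)
open import Relation.Nullary using (¬_; yes; no)
open import Relation.Binary.PropositionalEquality using (_≡_; _≢_)

Config : ℕ → ℕ → Set
Config q n = Fin n → Fin q

AutomataNetwork : ℕ → ℕ → Set
AutomataNetwork q n = Config q n → Config q n

update : ∀ {q n} → Config q n → Fin n → Fin q → Config q n
update x i a k with k ≟ i
... | yes _ = a
... | no  _ = x k

-- Arc (i , j) of the interaction graph: f_j effectively depends on x_i,
-- i.e. some x, x' differing only at i give f_j x ≠ f_j x'.
Arc : ∀ {q n} → AutomataNetwork q n → Fin n → Fin n → Set
Arc F i j = ∃ λ x → ∃ λ a → F x j ≢ F (update x i a) j

InDegreeAtMost1 : ∀ {q n} → AutomataNetwork q n → Fin n → Set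
InDegreeAtMost1 F j = ∀ i i' → Arc F i j → Arc F i' j → i ≡ i'

AlmostDegree1 : ∀ {q n} → AutomataNetwork q n → Set
AlmostDegree1 {q} {n} F =
  (∀ j → InDegreeAtMost1 F j) ⊎ (∃ λ v → ∀ j → j ≢ v → InDegreeAtMost1 F j)

iterate : ∀ {A : Set} → (A → A) → ℕ → A → A
iterate f zero    x = x
iterate f (suc m) x = f (iterate f m x)

OnLimitCycleOfLength : ∀ {q n} → AutomataNetwork q n → Config q n → ℕ → Set
OnLimitCycleOfLength F x p =
  1 ≤ p × iterate F p x ≡ x × (∀ m → 1 ≤ m → m < p → iterate F m x ≢ x)

LongestLimitCycleLength : ∀ {q n} → AutomataNetwork q n → ℕ → Set
LongestLimitCycleLength F k =
  (∃ λ x → OnLimitCycleOfLength F x k) ×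
  (∀ y p → OnLimitCycleOfLength F y p → p ≤ k)

-- A closed trail of length k in the de Bruijn graph of order n − 1, whose edges are the configurations,
-- gives the network: on the trail the first letter of a configuration is taken from its successor, off
-- the trail it is kept, and all other letters are shifted by one position. So every node but the first
-- copies a single neighbour; the trail is a limit cycle of length k, and a periodic configuration off the
-- trail never meets it, becomes constant after n shifts, and is therefore a fixed point.
--
-- Closed trails of every length 1 ≤ k ≤ qⁿ exist. A trail of order m gives one of order m + 1 of the
-- same length through the line graph. Longer trails come from the difference map D(x)ᵢ = xᵢ − xᵢ₊₁ (mod q),
-- which maps order m + 1 onto order m, q-to-1. The preimage of a closed trail through the zero loop, minus
-- r < q loops at constant words, is balanced, and it is connected when the trail carries closed walks of
-- letter-sum 0 and 1 and length ≡ 1 (mod q) avoiding the zero loop. Its Euler circuit is then a closed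
-- trail of length qk − r carrying the same walks. Low orders, especially for q = 2, use explicit trails.

module Submission where

open import Defs
open import Data.Bool as Bool using (Bool; true; false; if_then_else_)
import Data.Bool.Properties as BoolP
open import Data.Empty using (⊥-elim)
open import Data.Fin as Fin using (Fin; toℕ; fromℕ<; inject₁; #_)
open import Data.Fin.Properties as FinP using (toℕ-fromℕ<; toℕ-injective; toℕ<n; toℕ-inject₁; toℕ≤pred[n])
open import Data.List as List
  using (List; []; _∷_; _++_; [_]; length; map; filter; filterᵇ; concatMap; replicate; take; drop; allFin; tabulate)
open import Data.List.Properties
  using (∷-injective; ++-assoc; length-++; length-map; length-take; length-drop; length-tabulate; length-replicate;
         length-removeAt′; take++drop≡id)
open import Data.List.Membership.Propositional using (_∈_; _∉_; _─_; find; lose)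
open import Data.List.Membership.Propositional.Properties
  using (∈-++⁺ˡ; ∈-++⁺ʳ; ∈-++⁻; ∈-∃++; ∈-length; ∈-filter⁺; ∈-filter⁻; ∈-map⁺; ∈-map⁻; ∈-concatMap⁺; ∈-concatMap⁻;
         ∈-allFin; ∈-tabulate⁻)
import Data.List.Membership.DecPropositional as DecMembership
open import Data.List.Relation.Binary.Subset.Propositional using (_⊆_)
import Data.List.Relation.Binary.Subset.DecPropositional as DecSubset
import Data.List.Relation.Binary.Permutation.Setoid.Properties as Permutation
open import Data.List.Relation.Unary.Any using (here; there; any?)
import Data.List.Relation.Unary.All as All
import Data.List.Relation.Unary.All.Properties as AllP
open import Data.List.Relation.Unary.Unique.Propositional using (Unique; []; _∷_)
open import Data.List.Relation.Unary.Unique.Propositional.Properties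
  using (filter⁺; ++⁺; map⁺; map⁻; take⁺; drop⁺; tabulate⁺; allFin⁺; Unique[x∷xs]⇒x∉xs)
import Data.List.Relation.Unary.Unique.DecPropositional as DecUnique
open import Data.Maybe using (Maybe; just; nothing; maybe)
open import Data.Nat using (ℕ; zero; suc; _+_; _*_; _∸_; _^_; _≤_; _<_; z≤n; s≤s; _≤?_)
open import Data.Nat.DivMod using (_%_; m%n<n; %-distribˡ-+; m%n%n≡m%n; m<n⇒m%n≡m; m*n%n≡0; n%n≡0)
open import Data.Nat.Properties
  using (+-comm; +-assoc; +-suc; +-identityʳ; +-cancelʳ-≡; +-cancelˡ-≡; *-comm; *-identityʳ; *-zeroʳ; *-suc;
         ≤-refl; ≤-trans; ≤-reflexive; ≤-antisym; ≤-pred; <⇒≤; <⇒≱; ≰⇒>; ≮⇒≥; n≤1+n; m≤m+n; m≤m*n;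
         +-mono-≤; +-monoʳ-≤; +-monoˡ-≤; +-mono-<; +-monoʳ-<; *-cancelˡ-<; m+[n∸m]≡n; m∸n+n≡m; m∸n≡0⇒m≤n;
         m+n≤o⇒m≤o∸n; m≤n⇒m⊓n≡m; m≤n⇒∃[o]m+o≡n; +-commutativeSemigroup; module ≤-Reasoning)
open import Algebra.Properties.CommutativeSemigroup +-commutativeSemigroup using (x∙yz≈y∙xz; x∙yz≈zy∙x; xy∙z≈xz∙y; interchange)
open import Data.Nat.Tactic.RingSolver using (solve-∀)
open import Data.Product using (∃; ∃₂; _×_; _,_; proj₁; proj₂)
open import Data.Sum using (_⊎_; inj₁; inj₂; [_,_]′)
open import Data.Vec as Vec using (Vec; []; _∷_; head; tail; init; last; lookup)
open import Data.Vec.Properties using (≡-dec; lookup∘tabulate; tabulate∘lookup; tabulate-cong; lookup-replicate)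
open import Function using (_∘_; _∘′_; id; mk⇔)
open import Relation.Binary.Definitions using (DecidableEquality)
open import Relation.Binary.PropositionalEquality hiding ([_])
open import Relation.Nullary using (Dec; yes; no; ¬_; ¬?; does)
open import Relation.Nullary.Decidable using (True; toWitness; _×-dec_; decidable-stable; dec-true; dec-false; does-⇔)
open import Relation.Unary using (Decidable)

-- Arithmetic modulo q

-- The alphabet has q = 2 + p letters, so that 𝟘 ≢ 𝟙.
module ZMod (p : ℕ) where

  q : ℕ
  q = suc (suc p)

  Letter : Set
  Letter = Fin q

  infixl 6 _⊕_ _⊝_

  _⊕_ : Letter → Letter → Letter
  a ⊕ b = fromℕ< (m%n<n (toℕ a + toℕ b) q)

  ⊖_ : Letter → Letter
  ⊖ a = fromℕ< (m%n<n (q ∸ toℕ a) q)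

  _⊝_ : Letter → Letter → Letter
  a ⊝ b = a ⊕ (⊖ b)

  𝟘 𝟙 : Letter
  𝟘 = Fin.zero
  𝟙 = Fin.suc Fin.zero

  toℕ-⊕ : ∀ a b → toℕ (a ⊕ b) ≡ (toℕ a + toℕ b) % q
  toℕ-⊕ a b = toℕ-fromℕ< _

  %-absorbˡ : ∀ x y → (x % q + y) % q ≡ (x + y) % q
  %-absorbˡ x y = begin
    (x % q + y) % q           ≡⟨ %-distribˡ-+ (x % q) y q ⟩
    (x % q % q + y % q) % q   ≡⟨ cong (λ z → (z + y % q) % q) (m%n%n≡m%n x q) ⟩
    (x % q + y % q) % q       ≡⟨ %-distribˡ-+ x y q ⟨
    (x + y) % q               ∎
    where open ≡-Reasoning

  %-absorbʳ : ∀ x y → (x + y % q) % q ≡ (x + y) % q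
  %-absorbʳ x y = begin
    (x + y % q) % q  ≡⟨ cong (_% q) (+-comm x (y % q)) ⟩
    (y % q + x) % q  ≡⟨ %-absorbˡ y x ⟩
    (y + x) % q      ≡⟨ cong (_% q) (+-comm y x) ⟩
    (x + y) % q      ∎
    where open ≡-Reasoning

  ⊕-comm : ∀ a b → a ⊕ b ≡ b ⊕ a
  ⊕-comm a b = toℕ-injective (begin
    toℕ (a ⊕ b)              ≡⟨ toℕ-⊕ a b ⟩
    (toℕ a + toℕ b) % q      ≡⟨ cong (_% q) (+-comm (toℕ a) (toℕ b)) ⟩
    (toℕ b + toℕ a) % q      ≡⟨ toℕ-⊕ b a ⟨
    toℕ (b ⊕ a)              ∎)
    where open ≡-Reasoning

  ⊕-assoc : ∀ a b c → (a ⊕ b) ⊕ c ≡ a ⊕ (b ⊕ c)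
  ⊕-assoc a b c = toℕ-injective (begin
    toℕ ((a ⊕ b) ⊕ c)                   ≡⟨ toℕ-⊕ (a ⊕ b) c ⟩
    (toℕ (a ⊕ b) + toℕ c) % q           ≡⟨ cong (λ z → (z + toℕ c) % q) (toℕ-⊕ a b) ⟩
    ((toℕ a + toℕ b) % q + toℕ c) % q   ≡⟨ %-absorbˡ (toℕ a + toℕ b) (toℕ c) ⟩
    (toℕ a + toℕ b + toℕ c) % q         ≡⟨ cong (_% q) (+-assoc (toℕ a) (toℕ b) (toℕ c)) ⟩
    (toℕ a + (toℕ b + toℕ c)) % q       ≡⟨ %-absorbʳ (toℕ a) (toℕ b + toℕ c) ⟨
    (toℕ a + (toℕ b + toℕ c) % q) % q   ≡⟨ cong (λ z → (toℕ a + z) % q) (toℕ-⊕ b c) ⟨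
    (toℕ a + toℕ (b ⊕ c)) % q           ≡⟨ toℕ-⊕ a (b ⊕ c) ⟨
    toℕ (a ⊕ (b ⊕ c))                   ∎)
    where open ≡-Reasoning

  ⊕-identityˡ : ∀ a → 𝟘 ⊕ a ≡ a
  ⊕-identityˡ a = toℕ-injective (trans (toℕ-⊕ 𝟘 a) (m<n⇒m%n≡m (toℕ<n a)))

  ⊕-identityʳ : ∀ a → a ⊕ 𝟘 ≡ a
  ⊕-identityʳ a = trans (⊕-comm a 𝟘) (⊕-identityˡ a)

  ⊕-inverseʳ : ∀ a → a ⊝ a ≡ 𝟘
  ⊕-inverseʳ a = toℕ-injective (begin
    toℕ (a ⊕ ⊖ a)                    ≡⟨ toℕ-⊕ a (⊖ a) ⟩
    (toℕ a + toℕ (⊖ a)) % q          ≡⟨ cong (λ z → (toℕ a + z) % q) (toℕ-fromℕ< _) ⟩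
    (toℕ a + (q ∸ toℕ a) % q) % q    ≡⟨ %-absorbʳ (toℕ a) (q ∸ toℕ a) ⟩
    (toℕ a + (q ∸ toℕ a)) % q        ≡⟨ cong (_% q) (m+[n∸m]≡n (<⇒≤ (toℕ<n a))) ⟩
    q % q                            ≡⟨ n%n≡0 q ⟩
    0                                ∎)
    where open ≡-Reasoning

  ⊕-inverseˡ : ∀ a → ⊖ a ⊕ a ≡ 𝟘
  ⊕-inverseˡ a = trans (⊕-comm (⊖ a) a) (⊕-inverseʳ a)

  ⊝-⊕ : ∀ a b → a ⊝ b ⊕ b ≡ a
  ⊝-⊕ a b = trans (⊕-assoc a (⊖ b) b) (trans (cong (a ⊕_) (⊕-inverseˡ b)) (⊕-identityʳ a))

  ⊕-⊝ : ∀ a b → a ⊕ b ⊝ b ≡ a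
  ⊕-⊝ a b = trans (⊕-assoc a b (⊖ b)) (trans (cong (a ⊕_) (⊕-inverseʳ b)) (⊕-identityʳ a))

  ⊕-⊝-cancel : ∀ a c → a ⊕ (c ⊝ a) ≡ c
  ⊕-⊝-cancel a c = trans (⊕-comm a (c ⊝ a)) (⊝-⊕ c a)

  ⊕-exchangeʳ : ∀ a b c → (a ⊕ b) ⊕ c ≡ (a ⊕ c) ⊕ b
  ⊕-exchangeʳ a b c = trans (⊕-assoc a b c) (trans (cong (a ⊕_) (⊕-comm b c)) (sym (⊕-assoc a c b)))

  ⊕-interchange : ∀ a b c d → (a ⊕ b) ⊕ (c ⊕ d) ≡ (a ⊕ c) ⊕ (b ⊕ d)
  ⊕-interchange a b c d = begin
    (a ⊕ b) ⊕ (c ⊕ d)  ≡⟨ ⊕-assoc a b (c ⊕ d) ⟩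
    a ⊕ (b ⊕ (c ⊕ d))  ≡⟨ cong (a ⊕_) (⊕-assoc b c d) ⟨
    a ⊕ ((b ⊕ c) ⊕ d)  ≡⟨ cong (λ z → a ⊕ (z ⊕ d)) (⊕-comm b c) ⟩
    a ⊕ ((c ⊕ b) ⊕ d)  ≡⟨ cong (a ⊕_) (⊕-assoc c b d) ⟩
    a ⊕ (c ⊕ (b ⊕ d))  ≡⟨ ⊕-assoc a c (b ⊕ d) ⟨
    (a ⊕ c) ⊕ (b ⊕ d)  ∎
    where open ≡-Reasoning

  infixr 7 _·_

  _·_ : ℕ → Letter → Letter
  zero  · x = 𝟘
  suc n · x = x ⊕ n · x

  toℕ-· : ∀ n x → toℕ (n · x) ≡ (n * toℕ x) % q
  toℕ-· zero    x = refl
  toℕ-· (suc n) x = begin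
    toℕ (x ⊕ n · x)                 ≡⟨ toℕ-⊕ x (n · x) ⟩
    (toℕ x + toℕ (n · x)) % q       ≡⟨ cong (λ z → (toℕ x + z) % q) (toℕ-· n x) ⟩
    (toℕ x + (n * toℕ x) % q) % q   ≡⟨ %-absorbʳ (toℕ x) (n * toℕ x) ⟩
    (toℕ x + n * toℕ x) % q         ∎
    where open ≡-Reasoning

  q·x≡𝟘 : ∀ x → q · x ≡ 𝟘
  q·x≡𝟘 x = toℕ-injective (trans (toℕ-· q x) (trans (cong (_% q) (*-comm q (toℕ x))) (m*n%n≡0 (toℕ x) q)))

  [1+q]·x≡x : ∀ x → suc q · x ≡ x
  [1+q]·x≡x x = trans (cong (x ⊕_) (q·x≡𝟘 x)) (⊕-identityʳ x)

  toℕ[c]·𝟙≡c : ∀ c → toℕ c · 𝟙 ≡ c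
  toℕ[c]·𝟙≡c c = toℕ-injective (trans (toℕ-· (toℕ c) 𝟙)
    (trans (cong (_% q) (*-identityʳ (toℕ c))) (m<n⇒m%n≡m (toℕ<n c))))

indicator : Bool → ℕ
indicator true  = 1
indicator false = 0

module _ {A : Set} where

  count : (A → Bool) → List A → ℕ
  count f []       = 0
  count f (x ∷ xs) = indicator (f x) + count f xs

  count-++ : ∀ f xs ys → count f (xs ++ ys) ≡ count f xs + count f ys
  count-++ f []       ys = refl
  count-++ f (x ∷ xs) ys = trans (cong (indicator (f x) +_) (count-++ f xs ys)) (sym (+-assoc (indicator (f x)) _ _))

  count-cong : ∀ {f g} xs → (∀ {x} → x ∈ xs → f x ≡ g x) → count f xs ≡ count g xs
  count-cong []       f≗g = refl
  count-cong (x ∷ xs) f≗g = cong₂ _+_ (cong indicator (f≗g (here refl))) (count-cong xs (f≗g ∘ there))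

  count-false : ∀ {f} xs → (∀ {x} → x ∈ xs → f x ≡ false) → count f xs ≡ 0
  count-false []       f≡false = refl
  count-false (x ∷ xs) f≡false rewrite f≡false (here refl) = count-false xs (λ x∈ → f≡false (there x∈))

  count≡length∘filterᵇ : ∀ f xs → count f xs ≡ length (filterᵇ f xs)
  count≡length∘filterᵇ f []       = refl
  count≡length∘filterᵇ f (x ∷ xs) with f x
  ... | true  = cong suc (count≡length∘filterᵇ f xs)
  ... | false = count≡length∘filterᵇ f xs

  ∈-─ : ∀ {x z} {ys : List A} (x∈ : x ∈ ys) → z ∈ ys → z ≢ x → z ∈ ys ─ x∈
  ∈-─ (here refl) (here refl) z≢x = ⊥-elim (z≢x refl)
  ∈-─ (here refl) (there z∈)  z≢x = z∈
  ∈-─ (there x∈)  (here refl) z≢x = here refl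
  ∈-─ (there x∈)  (there z∈)  z≢x = there (∈-─ x∈ z∈ z≢x)

  Unique-⊆⇒length≤ : ∀ {xs ys : List A} → Unique xs → xs ⊆ ys → length xs ≤ length ys
  Unique-⊆⇒length≤ {[]}     _          _  = z≤n
  Unique-⊆⇒length≤ {x ∷ xs} {ys} u@(_ ∷ uxs) xs⊆ys =
    subst (suc (length xs) ≤_) (sym (length-removeAt′ ys _))
      (s≤s (Unique-⊆⇒length≤ uxs (λ z∈ → ∈-─ x∈ys (xs⊆ys (there z∈)) (λ { refl → Unique[x∷xs]⇒x∉xs u z∈ }))))
    where x∈ys = xs⊆ys (here refl)

  count-mono : ∀ f {xs ys : List A} → Unique xs → (∀ {z} → z ∈ xs → f z ≡ true → z ∈ ys) → count f xs ≤ count f ys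
  count-mono f {xs} {ys} uxs sub =
    subst₂ _≤_ (sym (count≡length∘filterᵇ f xs)) (sym (count≡length∘filterᵇ f ys))
      (Unique-⊆⇒length≤ (filter⁺ (Bool.T? ∘ f) uxs) λ z∈ →
        let z∈xs , fz = ∈-filter⁻ (Bool.T? ∘ f) z∈ in ∈-filter⁺ (Bool.T? ∘ f) (sub z∈xs (T⇒≡ fz)) fz)
    where
    T⇒≡ : ∀ {b} → Bool.T b → b ≡ true
    T⇒≡ {true} _ = refl

  count-partition : ∀ h {P : A → Set} (P? : Decidable P) xs →
                    count h xs ≡ count h (filter P? xs) + count h (filter (¬? ∘ P?) xs)
  count-partition h P? [] = refl
  count-partition h P? (x ∷ xs) with P? x
  ... | yes _ = trans (cong (indicator (h x) +_) (count-partition h P? xs)) (sym (+-assoc (indicator (h x)) _ _))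
  ... | no  _ = trans (cong (indicator (h x) +_) (count-partition h P? xs))
                      (x∙yz≈y∙xz (indicator (h x)) (count h (filter P? xs)) _)

  Unique-middle⇒∉ : ∀ xs {a} {ys : List A} → Unique (xs ++ a ∷ ys) → a ∉ xs
  Unique-middle⇒∉ (x ∷ xs) (x≢ ∷ _) (here refl) = All.lookup x≢ (∈-++⁺ʳ xs (here refl)) refl
  Unique-middle⇒∉ (x ∷ xs) (_ ∷ u)  (there a∈)  = Unique-middle⇒∉ xs u a∈

  Unique-++⇒∉ : ∀ {xs ys : List A} {x} → Unique (xs ++ ys) → x ∈ xs → x ∉ ys
  Unique-++⇒∉ {xs} u x∈xs x∈ys with ∈-∃++ x∈ys
  ... | ys₁ , ys₂ , refl = Unique-middle⇒∉ (xs ++ ys₁) (subst Unique (sym (++-assoc xs ys₁ _)) u) (∈-++⁺ˡ x∈xs)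

  module _ (_≟_ : DecidableEquality A) where
    open DecMembership _≟_ using (_∈?_)

    count-witness : ∀ f {xs ys : List A} → Unique ys → count f xs < count f ys →
                    ∃ λ y → y ∈ ys × f y ≡ true × y ∉ xs
    count-witness f {xs} {ys} uys lt with any? (λ y → (f y BoolP.≟ true) ×-dec ¬? (y ∈? xs)) ys
    ... | yes some = let y , y∈ , fy , y∉ = find some in y , y∈ , fy , y∉
    ... | no none  = ⊥-elim (<⇒≱ lt (count-mono f uys λ {z} z∈ fz →
                       decidable-stable (z ∈? xs) (λ z∉ → none (lose z∈ (fz , z∉)))))

    count-≟-unique : ∀ {x} {xs : List A} → Unique xs → x ∈ xs → count (λ y → does (y ≟ x)) xs ≡ 1
    count-≟-unique {x} {.x ∷ ys} (x≢ys ∷ _) (here refl) =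
      cong₂ _+_ (cong indicator (dec-true (x ≟ x) refl))
                (count-false ys (λ z∈ → dec-false (_ ≟ x) (≢-sym (All.lookup x≢ys z∈))))
    count-≟-unique {x} {y ∷ ys} (y≢ys ∷ u) (there x∈) =
      cong₂ _+_ (cong indicator (dec-false (y ≟ x) (All.lookup y≢ys x∈))) (count-≟-unique u x∈)

length-concatMap-const : ∀ {A B : Set} {h : A → List B} c → (∀ x → length (h x) ≡ c) →
                         ∀ xs → length (concatMap h xs) ≡ c * length xs
length-concatMap-const {h = h} c len []       = sym (*-zeroʳ c)
length-concatMap-const {h = h} c len (x ∷ xs) =
  trans (length-++ (h x)) (trans (cong₂ _+_ (len x) (length-concatMap-const c len xs)) (sym (*-suc c (length xs))))

count-map : ∀ {A B : Set} f (g : B → A) xs → count f (map g xs) ≡ count (f ∘ g) xs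
count-map f g []       = refl
count-map f g (x ∷ xs) = cong (indicator (f (g x)) +_) (count-map f g xs)

module _ {A B : Set} {h : A → List B} (tag : B → A) (tagged : ∀ {x z} → z ∈ h x → tag z ≡ x) where

  Unique-concatMap⁺ : ∀ {xs} → (∀ {x} → x ∈ xs → Unique (h x)) → Unique xs → Unique (concatMap h xs)
  Unique-concatMap⁺ {[]}     _        _            = []
  Unique-concatMap⁺ {x ∷ xs} unique-h u@(_ ∷ uxs) =
    ++⁺ (unique-h (here refl)) (Unique-concatMap⁺ (unique-h ∘ there) uxs) disjoint
    where
    disjoint : ∀ {z} → ¬ (z ∈ h x × z ∈ concatMap h xs)
    disjoint (z∈hx , z∈hxs) =
      let y , y∈xs , z∈hy = find (∈-concatMap⁻ h {xs = xs} z∈hxs) in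
      Unique[x∷xs]⇒x∉xs u (subst (_∈ xs) (trans (sym (tagged z∈hy)) (tagged z∈hx)) y∈xs)

∈-replicate⁻ : ∀ {A : Set} n {x z : A} → z ∈ replicate n x → z ≡ x
∈-replicate⁻ (suc n) (here z≡x) = z≡x
∈-replicate⁻ (suc n) (there z∈) = ∈-replicate⁻ n z∈

∷-snoc : ∀ {A : Set} (x : A) xs → ∃₂ λ ys y → x ∷ xs ≡ ys ++ [ y ]
∷-snoc x []       = [] , x , refl
∷-snoc x (y ∷ ys) = let zs , z , eq = ∷-snoc y ys in x ∷ zs , z , cong (x ∷_) eq

length-take-≤ : ∀ {A : Set} n (xs : List A) → n ≤ length xs → length (take n xs) ≡ n
length-take-≤ n xs n≤ = trans (length-take n xs) (m≤n⇒m⊓n≡m n≤)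

take⊆ : ∀ {A : Set} n (xs : List A) → take n xs ⊆ xs
take⊆ n xs = subst (_ ∈_) (take++drop≡id n xs) ∘ ∈-++⁺ˡ

drop⊆ : ∀ {A : Set} n (xs : List A) → drop n xs ⊆ xs
drop⊆ n xs = subst (_ ∈_) (take++drop≡id n xs) ∘ ∈-++⁺ʳ (take n xs)

-- Walks, closed trails and Euler circuits

module Walks {V E : Set} (_≟V_ : DecidableEquality V) (_≟E_ : DecidableEquality E) (src dst : E → V) where

  open DecMembership _≟E_ using (_∈?_)
  open Permutation (setoid E) using (++-comm; Unique-resp-↭; ∈-resp-↭)

  Walk : V → List E → V → Set
  Walk u []       v = u ≡ v
  Walk u (e ∷ es) v = src e ≡ u × Walk (dst e) es v

  walk-++ : ∀ {u v w} xs {ys} → Walk u xs v → Walk v ys w → Walk u (xs ++ ys) w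
  walk-++ []       refl       w₂ = w₂
  walk-++ (e ∷ xs) (se , w₁) w₂ = se , walk-++ xs w₁ w₂

  walk-split : ∀ {u w} xs {ys} → Walk u (xs ++ ys) w → ∃ λ v → Walk u xs v × Walk v ys w
  walk-split []       w₁₂        = _ , refl , w₁₂
  walk-split (e ∷ xs) (se , w₁₂) = let v , w₁ , w₂ = walk-split xs w₁₂ in v , (se , w₁) , w₂

  walk-concatMap : ∀ {A : Set} {u} (h : A → List E) → (∀ x → Walk u (h x) u) → ∀ xs → Walk u (concatMap h xs) u
  walk-concatMap h closed []       = refl
  walk-concatMap h closed (x ∷ xs) = walk-++ (h x) (closed x) (walk-concatMap h closed xs)

  closedWalk-rotate : ∀ {u} xs ys → Walk u (xs ++ ys) u → ∃ λ v → Walk v (ys ++ xs) v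
  closedWalk-rotate xs ys c = let v , w₁ , w₂ = walk-split xs c in v , walk-++ ys w₂ w₁

  closedWalk-successor : ∀ {u T} → Walk u T u → ∀ {e} → e ∈ T → ∃ λ e′ → e′ ∈ T × src e′ ≡ dst e
  closedWalk-successor {T = T} c {e} e∈T with ∈-∃++ e∈T
  ... | as , bs , refl with closedWalk-rotate as (e ∷ bs) c
  ... | _ , (se , c′) with bs ++ as in eq
  ...   | []      = e , e∈T , trans se (sym c′)
  ...   | f ∷ _   = f , ∈-resp-↭ (++-comm (e ∷ bs) as) (there (subst (f ∈_) (sym eq) (here refl))) , proj₁ c′

  ClosedTrail : V → List E → Set
  ClosedTrail w T = Walk w T w × Unique T

  closedTrail-rotateTo : ∀ {w T g} → ClosedTrail w T → g ∈ T →
    ∃ λ T′ → ClosedTrail (src g) (g ∷ T′) × T ⊆ g ∷ T′ × g ∷ T′ ⊆ T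
  closedTrail-rotateTo (c , u) g∈T with ∈-∃++ g∈T
  ... | as , bs , refl with closedWalk-rotate as (_ ∷ bs) c
  ... | _ , (sg , c′) =
    bs ++ as ,
    ((refl , subst (Walk _ (bs ++ as)) (sym sg) c′) , Unique-resp-↭ (++-comm as (_ ∷ bs)) u) ,
    ∈-resp-↭ (++-comm as (_ ∷ bs)) , ∈-resp-↭ (++-comm (_ ∷ bs) as)

  outDeg inDeg : List E → V → ℕ
  outDeg S u = count (λ e → does (src e ≟V u)) S
  inDeg  S u = count (λ e → does (dst e ≟V u)) S

  Balanced : List E → Set
  Balanced S = ∀ u → outDeg S u ≡ inDeg S u

  [_≟_] : V → V → ℕ
  [ u ≟ v ] = indicator (does (u ≟V v))

  walk-degrees : ∀ {u v} es → Walk u es v → ∀ x → outDeg es x + [ v ≟ x ] ≡ inDeg es x + [ u ≟ x ]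
  walk-degrees []       refl     x = refl
  walk-degrees (e ∷ es) (refl , w) x = begin
    [ src e ≟ x ] + outDeg es x + _      ≡⟨ +-assoc [ src e ≟ x ] (outDeg es x) _ ⟩
    [ src e ≟ x ] + (outDeg es x + _)    ≡⟨ cong ([ src e ≟ x ] +_) (walk-degrees es w x) ⟩
    [ src e ≟ x ] + (inDeg es x + [ dst e ≟ x ])  ≡⟨ x∙yz≈zy∙x [ src e ≟ x ] (inDeg es x) [ dst e ≟ x ] ⟩
    [ dst e ≟ x ] + inDeg es x + [ src e ≟ x ]    ∎
    where open ≡-Reasoning

  closedWalk⇒Balanced : ∀ {u} es → Walk u es u → Balanced es
  closedWalk⇒Balanced es c x = +-cancelʳ-≡ _ _ _ (walk-degrees es c x)

  Balanced-++ : ∀ {xs ys} → Balanced xs → Balanced ys → Balanced (xs ++ ys)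
  Balanced-++ {xs} {ys} bal-xs bal-ys u =
    trans (count-++ _ xs ys) (trans (cong₂ _+_ (bal-xs u) (bal-ys u)) (sym (count-++ _ xs ys)))

  Balanced-loops : ∀ {L} → (∀ {e} → e ∈ L → src e ≡ dst e) → Balanced L
  Balanced-loops {L} loop u = count-cong L (λ e∈ → cong (λ x → does (x ≟V u)) (loop e∈))

  Reaches : List E → V → V → Set
  Reaches S u v = ∃ λ P → Walk u P v × P ⊆ S

  reaches-trans : ∀ {S u v w} → Reaches S u v → Reaches S v w → Reaches S u w
  reaches-trans (P , c , P⊆S) (Q , d , Q⊆S) = P ++ Q , walk-++ P c d , [ P⊆S , Q⊆S ]′ ∘ ∈-++⁻ P


  ≟V-sound : ∀ {a b} → does (a ≟V b) ≡ true → a ≡ b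
  ≟V-sound {a} {b} h with a ≟V b | h
  ... | yes a≡b | _ = a≡b

  module _ {R : List E} (uR : Unique R) (balR : Balanced R) where

    unusedOutEdge : ∀ {s v P} → Walk s P v → v ≢ s → Unique P → P ⊆ R → ∃ λ e → e ∈ R × src e ≡ v × e ∉ P
    unusedOutEdge {s} {v} {P} w v≢s uP P⊆R =
      let e , e∈R , se , e∉P = count-witness _≟E_ _ uR out<out in e , e∈R , ≟V-sound se , e∉P
      where
      out+1≡in : outDeg P v + 1 ≡ inDeg P v
      out+1≡in = begin
        outDeg P v + 1              ≡⟨ cong (λ b → outDeg P v + indicator b) (dec-true (v ≟V v) refl) ⟨
        outDeg P v + [ v ≟ v ]      ≡⟨ walk-degrees P w v ⟩
        inDeg P v + [ s ≟ v ]       ≡⟨ cong (λ b → inDeg P v + indicator b) (dec-false (s ≟V v) (v≢s ∘ sym)) ⟩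
        inDeg P v + 0               ≡⟨ +-identityʳ _ ⟩
        inDeg P v                   ∎
        where open ≡-Reasoning
      out<out : outDeg P v < outDeg R v
      out<out = subst (suc (outDeg P v) ≤_) (sym (balR v))
        (≤-trans (≤-reflexive (trans (+-comm 1 (outDeg P v)) out+1≡in)) (count-mono _ uP (λ z∈ _ → P⊆R z∈)))

    ClosedTrailThrough : E → Set
    ClosedTrailThrough f = ∃ λ C → ClosedTrail (src f) C × C ⊆ R × f ∈ C

    extendTrail : ∀ n {f} P {v} → Walk (src f) P v → Unique P → P ⊆ R → f ∈ P →
                  length R < n + length P → ClosedTrailThrough f
    extendTrail zero    P w uP P⊆R f∈P bound = ⊥-elim (<⇒≱ bound (Unique-⊆⇒length≤ uP P⊆R))
    extendTrail (suc n) {f} P {v} w uP P⊆R f∈P bound with v ≟V src f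
    ... | yes refl = P , (w , uP) , P⊆R , f∈P
    ... | no v≢s =
      let e , e∈R , se , e∉P = unusedOutEdge w v≢s uP P⊆R in
      extendTrail n (P ++ [ e ]) (walk-++ P w (se , refl))
        (++⁺ uP (All.[] ∷ []) (λ { (z∈P , here refl) → e∉P z∈P }))
        ([ P⊆R , (λ { (here refl) → e∈R }) ]′ ∘ ∈-++⁻ P)
        (∈-++⁺ˡ f∈P)
        (subst (length R <_) (trans (sym (+-suc n (length P))) (cong (n +_) (trans (+-comm 1 (length P)) (sym (length-++ P))))) bound)

    closedTrailThrough : ∀ {f} → f ∈ R → ClosedTrailThrough f
    closedTrailThrough f∈R = extendTrail (length R) [ _ ] (refl , refl) (All.[] ∷ []) (λ { (here refl) → f∈R }) (here refl)
      (subst (length R <_) (+-comm 1 (length R)) (s≤s ≤-refl))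

  infixl 5 _∖_
  _∖_ : List E → List E → List E
  S ∖ T = filter (¬? ∘ (_∈? T)) S

  ∈-∖⁻ : ∀ {S T e} → e ∈ S ∖ T → e ∈ S × e ∉ T
  ∈-∖⁻ {S} {T} = ∈-filter⁻ (¬? ∘ (_∈? T)) {xs = S}

  ∈-∖⁺ : ∀ {S T e} → e ∈ S → e ∉ T → e ∈ S ∖ T
  ∈-∖⁺ {S} {T} = ∈-filter⁺ (¬? ∘ (_∈? T))

  Unique-∖ : ∀ {S} T → Unique S → Unique (S ∖ T)
  Unique-∖ T = filter⁺ (¬? ∘ (_∈? T))

  Balanced-∖ : ∀ {S T} → Unique S → Unique T → T ⊆ S → Balanced S → Balanced T → Balanced (S ∖ T)
  Balanced-∖ {S} {T} uS uT T⊆S balS balT u =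
    +-cancelˡ-≡ (outDeg T u) _ _ (begin
      outDeg T u + outDeg (S ∖ T) u   ≡⟨ split _ ⟨
      outDeg S u                      ≡⟨ balS u ⟩
      inDeg S u                       ≡⟨ split _ ⟩
      inDeg T u + inDeg (S ∖ T) u     ≡⟨ cong (_+ inDeg (S ∖ T) u) (balT u) ⟨
      outDeg T u + inDeg (S ∖ T) u    ∎)
    where
    open ≡-Reasoning
    split : ∀ h → count h S ≡ count h T + count h (S ∖ T)
    split h = trans (count-partition h (_∈? T) S) (cong (_+ count h (S ∖ T)) (≤-antisym
      (count-mono h (filter⁺ (_∈? T) uS) (λ z∈ _ → proj₂ (∈-filter⁻ (_∈? T) {xs = S} z∈)))
      (count-mono h uT (λ z∈ _ → ∈-filter⁺ (_∈? T) (T⊆S z∈) z∈))))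

  module _ {S : List E} (uS : Unique S) (balS : Balanced S) {e₀} (e₀∈S : e₀ ∈ S)
           (connected : ∀ {e} → e ∈ S → Reaches S (src e₀) (src e)) where

    Touches : List E → V → Set
    Touches T x = ∃ λ g → g ∈ T × src g ≡ x

    exitEdge : ∀ {w T} → Walk w T w → ∀ {x y} P → Walk x P y → P ⊆ S → Touches T x →
               ∀ {e} → e ∈ S → e ∉ T → src e ≡ y → ∃ λ f → f ∈ S × f ∉ T × Touches T (src f)
    exitEdge c []      refl _ touch e∈S e∉T refl = _ , e∈S , e∉T , touch
    exitEdge {T = T} c (p ∷ P) (sp , cP) P⊆S (g , g∈T , sg) e∈S e∉T se with p ∈? T
    ... | no p∉T  = p , P⊆S (here refl) , p∉T , g , g∈T , trans sg (sym sp)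
    ... | yes p∈T = exitEdge c P cP (P⊆S ∘ there) (closedWalk-successor c p∈T) e∈S e∉T se

    spliceIn : ∀ {w T} → ClosedTrail w T → T ⊆ S → e₀ ∈ T → ∀ {f} → f ∈ S → f ∉ T → Touches T (src f) →
               ∃ λ T′ → ∃ λ w′ → ClosedTrail w′ T′ × T′ ⊆ S × e₀ ∈ T′ × length T < length T′
    spliceIn {T = T} (c , uT) T⊆S e₀∈T {f} f∈S f∉T (g , g∈T , sg)
      with closedTrailThrough (Unique-∖ T uS) (Balanced-∖ uS uT T⊆S balS (closedWalk⇒Balanced T c)) (∈-∖⁺ {S} {T} f∈S f∉T)
         | closedTrail-rotateTo (c , uT) g∈T
    ... | C , (cC , uC) , C⊆S∖T , f∈C | Tg , (cTg , uTg) , T⊆Tg , Tg⊆T =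
      C ++ g ∷ Tg , src f ,
      (walk-++ C cC (subst (λ x → Walk x (g ∷ Tg) x) sg cTg) ,
       ++⁺ uC uTg (λ (z∈C , z∈Tg) → proj₂ (∈-∖⁻ {S} {T} (C⊆S∖T z∈C)) (Tg⊆T z∈Tg))) ,
      [ proj₁ ∘ ∈-∖⁻ {S} {T} ∘ C⊆S∖T , T⊆S ∘ Tg⊆T ]′ ∘ ∈-++⁻ C ,
      ∈-++⁺ʳ C (T⊆Tg e₀∈T) ,
      subst (length T <_) (sym (length-++ C)) (+-mono-≤ (∈-length f∈C) (Unique-⊆⇒length≤ uT T⊆Tg))

    EulerCircuit : Set
    EulerCircuit = ∃ λ T → ∃ λ w → ClosedTrail w T × T ⊆ S × S ⊆ T

    grow : ∀ n {w T} → ClosedTrail w T → T ⊆ S → e₀ ∈ T → length S < n + length T → EulerCircuit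
    grow zero ct T⊆S _ bound = ⊥-elim (<⇒≱ bound (Unique-⊆⇒length≤ (proj₂ ct) T⊆S))
    grow (suc n) {w} {T} ct T⊆S e₀∈T bound with any? (¬? ∘ (_∈? T)) S
    ... | no none  = T , w , ct , T⊆S , λ e∈S → decidable-stable (_ ∈? T) (λ e∉T → none (lose e∈S e∉T))
    ... | yes some =
      let e , e∈S , e∉T = find some
          P , cP , P⊆S = connected e∈S
          f , f∈S , f∉T , touch = exitEdge (proj₁ ct) P cP P⊆S (e₀ , e₀∈T , refl) e∈S e∉T refl
          T′ , _ , ct′ , T′⊆S , e₀∈T′ , longer = spliceIn ct T⊆S e₀∈T f∈S f∉T touch
      in grow n ct′ T′⊆S e₀∈T′
           (≤-trans bound (subst (_≤ n + length T′) (+-suc n (length T)) (+-monoʳ-≤ n longer)))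

    eulerCircuit : EulerCircuit
    eulerCircuit =
      let C , ct , C⊆S , e₀∈C = closedTrailThrough uS balS e₀∈S in
      grow (length S) ct C⊆S e₀∈C (subst (_≤ length S + length C) (+-comm (length S) 1) (+-monoʳ-≤ (length S) (∈-length e₀∈C)))

-- Words and the difference map

module Words (p : ℕ) where

  open ZMod p public

  Word : ℕ → Set
  Word = Vec Letter

  𝟎 : ∀ {n} → Word n
  𝟎 = Vec.replicate _ 𝟘

  init-∷ : ∀ {n} x (w : Word (suc n)) → init (x ∷ w) ≡ x ∷ init w
  init-∷ x (_ ∷ _) = refl

  last-∷ : ∀ {n} x (w : Word (suc n)) → last (x ∷ w) ≡ last w
  last-∷ x (_ ∷ _) = refl

  init-replicate : ∀ n (c : Letter) → init (Vec.replicate (suc n) c) ≡ Vec.replicate n c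
  init-replicate zero    c = refl
  init-replicate (suc n) c = cong (c ∷_) (init-replicate n c)

  last-replicate : ∀ n (c : Letter) → last (Vec.replicate (suc n) c) ≡ c
  last-replicate zero    c = refl
  last-replicate (suc n) c = last-replicate n c

  D : ∀ {n} → Word (suc n) → Word n
  D (x ∷ [])     = []
  D (x ∷ y ∷ ys) = (x ⊝ y) ∷ D (y ∷ ys)

  D-∷ : ∀ {n} x (w : Word (suc n)) → D (x ∷ w) ≡ (x ⊝ head w) ∷ D w
  D-∷ x (_ ∷ _) = refl

  D-replicate : ∀ n c → D (Vec.replicate (suc n) c) ≡ 𝟎
  D-replicate zero    c = refl
  D-replicate (suc n) c = cong₂ _∷_ (⊕-inverseʳ c) (D-replicate n c)

  integrate : ∀ {n} → Letter → Word n → Word (suc n)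
  integrate b []       = b ∷ []
  integrate b (d ∷ ds) = (d ⊕ head (integrate b ds)) ∷ integrate b ds

  D-integrate : ∀ {n} b (v : Word n) → D (integrate b v) ≡ v
  D-integrate b []       = refl
  D-integrate b (d ∷ ds) = trans (D-∷ (d ⊕ head (integrate b ds)) (integrate b ds)) (cong₂ _∷_ (⊕-⊝ d _) (D-integrate b ds))

  last-integrate : ∀ {n} b (v : Word n) → last (integrate b v) ≡ b
  last-integrate b []       = refl
  last-integrate b (d ∷ ds) = trans (last-∷ (d ⊕ head (integrate b ds)) (integrate b ds)) (last-integrate b ds)

  integrate-D : ∀ {n} (w : Word (suc n)) → integrate (last w) (D w) ≡ w
  integrate-D (x ∷ [])     = refl
  integrate-D (x ∷ y ∷ ys) = cong₂ _∷_ (trans (cong (λ w → (x ⊝ y) ⊕ head w) ih) (⊝-⊕ x y)) ih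
    where ih = integrate-D (y ∷ ys)

  integrate-injective : ∀ {n} {b b′} {v v′ : Word n} → integrate b v ≡ integrate b′ v′ → b ≡ b′ × v ≡ v′
  integrate-injective {b = b} {b′} {v} {v′} eq =
    trans (sym (last-integrate b v)) (trans (cong last eq) (last-integrate b′ v′)) ,
    trans (sym (D-integrate b v)) (trans (cong D eq) (D-integrate b′ v′))

  tail-integrate : ∀ {n} b (v : Word (suc n)) → tail (integrate b v) ≡ integrate b (tail v)
  tail-integrate b (_ ∷ _) = refl

  init-integrate : ∀ {n} b (v : Word (suc n)) → init (integrate b v) ≡ integrate (b ⊕ last v) (init v)
  init-integrate b (d ∷ [])     = cong (_∷ []) (⊕-comm d b)
  init-integrate b (d ∷ e ∷ es) = begin
    init ((d ⊕ head R) ∷ R)     ≡⟨ init-∷ _ R ⟩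
    (d ⊕ head R) ∷ init R       ≡⟨ cong₂ (λ h t → (d ⊕ h) ∷ t) (trans (sym (head-init R)) (cong head ih)) ih ⟩
    (d ⊕ head R′) ∷ R′          ∎
    where
    open ≡-Reasoning
    R  = integrate b (e ∷ es)
    R′ = integrate (b ⊕ last (e ∷ es)) (init (e ∷ es))
    ih = init-integrate b (e ∷ es)
    head-init : ∀ {n} (w : Word (suc (suc n))) → head (init w) ≡ head w
    head-init (_ ∷ _ ∷ _) = refl

  integrate-𝟎 : ∀ {n} b → integrate {n} b 𝟎 ≡ Vec.replicate (suc n) b
  integrate-𝟎 {zero}  b = refl
  integrate-𝟎 {suc n} b = cong₂ _∷_ (trans (cong (λ w → 𝟘 ⊕ head w) (integrate-𝟎 {n} b)) (⊕-identityˡ b)) (integrate-𝟎 {n} b)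

-- The shift-register network of a closed trail

module _ {A : Set} (f : A → A) where

  iterate-+ : ∀ m n x → iterate f (m + n) x ≡ iterate f m (iterate f n x)
  iterate-+ zero    n x = refl
  iterate-+ (suc m) n x = cong f (iterate-+ m n x)

  iterate-suc : ∀ n x → iterate f (suc n) x ≡ iterate f n (f x)
  iterate-suc n x = trans (cong (λ m → iterate f m x) (+-comm 1 n)) (iterate-+ n 1 x)

  iterate-periodic : ∀ {p x} i → iterate f p x ≡ x → iterate f (i * p) x ≡ x
  iterate-periodic         zero    _   = refl
  iterate-periodic {p} {x} (suc i) per = trans (iterate-+ p (i * p) x) (trans (cong (iterate f p) (iterate-periodic i per)) per)

  iterate-comm : ∀ m n x → iterate f m (iterate f n x) ≡ iterate f n (iterate f m x)
  iterate-comm m n x = trans (sym (iterate-+ m n x)) (trans (cong (λ k → iterate f k x) (+-comm m n)) (iterate-+ n m x))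

module _ {A B : Set} {F : B → B} {G : A → A} (φ : A → B) (F∘φ≗φ∘G : ∀ a → F (φ a) ≡ φ (G a)) where

  iterate-conjugate : ∀ n a → iterate F n (φ a) ≡ φ (iterate G n a)
  iterate-conjugate zero    a = refl
  iterate-conjugate (suc n) a = trans (cong F (iterate-conjugate n a)) (F∘φ≗φ∘G (iterate G n a))

period≤ : ∀ {q n} {F : AutomataNetwork q n} {x p k} → OnLimitCycleOfLength F x p → 1 ≤ k → iterate F k x ≡ x → p ≤ k
period≤ {p = p} {k} (_ , _ , minimal) 1≤k per with p ≤? k
... | yes p≤k = p≤k
... | no  p≰k = ⊥-elim (minimal k 1≤k (≰⇒> p≰k) per)

module CyclicOrbit {A : Set} (G : A → A) (t₀ : A) (rest : List A) (unique : Unique (t₀ ∷ rest))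
  (G-next : ∀ xs {a b ys} → t₀ ∷ rest ≡ xs ++ a ∷ b ∷ ys → G a ≡ b)
  (G-last : ∀ xs {a} → t₀ ∷ rest ≡ xs ++ [ a ] → G a ≡ t₀) where

  private
    T : List A
    T = t₀ ∷ rest

  k : ℕ
  k = length T

  iterate-along : ∀ xs {a y ys} pre → T ≡ pre ++ a ∷ xs ++ y ∷ ys → iterate G (suc (length xs)) a ≡ y
  iterate-along []       pre eq = G-next pre eq
  iterate-along (x ∷ xs) {a} pre eq = begin
    iterate G (suc (suc (length xs))) a   ≡⟨ iterate-suc G (suc (length xs)) a ⟩
    iterate G (suc (length xs)) (G a)     ≡⟨ cong (iterate G (suc (length xs))) (G-next pre eq) ⟩
    iterate G (suc (length xs)) x         ≡⟨ iterate-along xs (pre ++ [ a ]) (trans eq (sym (++-assoc pre [ a ] _))) ⟩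
    _                                     ∎
    where open ≡-Reasoning

  iterate-t₀ : ∀ xs {y ys} → T ≡ xs ++ y ∷ ys → iterate G (length xs) t₀ ≡ y
  iterate-t₀ []       eq = proj₁ (∷-injective eq)
  iterate-t₀ (x ∷ xs) eq = iterate-along xs [] (cong (t₀ ∷_) (proj₂ (∷-injective eq)))

  t₀-periodic : iterate G k t₀ ≡ t₀
  t₀-periodic with ∷-snoc t₀ rest
  ... | xs , a , eq = begin
    iterate G k t₀                       ≡⟨ cong (λ n → iterate G n t₀) k≡ ⟩
    G (iterate G (length xs) t₀)         ≡⟨ cong G (iterate-t₀ xs eq) ⟩
    G a                                  ≡⟨ G-last xs eq ⟩
    t₀                                   ∎
    where
    open ≡-Reasoning
    k≡ : k ≡ suc (length xs)
    k≡ = trans (cong length eq) (trans (length-++ xs) (+-comm (length xs) 1))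

  t₀-minimal : ∀ j → 1 ≤ j → j < k → iterate G j t₀ ≢ t₀
  t₀-minimal (suc j) _ (s≤s j<|rest|) with drop j rest in eq
  ... | []     = ⊥-elim (<⇒≱ j<|rest| (m∸n≡0⇒m≤n (trans (sym (length-drop j rest)) (cong length eq))))
  ... | y ∷ ys = λ Gʲ⁺¹t₀≡t₀ → Unique[x∷xs]⇒x∉xs unique (subst (_∈ rest) (trans (sym Gʲ⁺¹t₀≡y) Gʲ⁺¹t₀≡t₀) y∈rest)
    where
    rest≡ : rest ≡ take j rest ++ y ∷ ys
    rest≡ = trans (sym (take++drop≡id j rest)) (cong (take j rest ++_) eq)
    y∈rest : y ∈ rest
    y∈rest = subst (y ∈_) (sym rest≡) (∈-++⁺ʳ (take j rest) (here refl))
    Gʲ⁺¹t₀≡y : iterate G (suc j) t₀ ≡ y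
    Gʲ⁺¹t₀≡y = subst (λ n → iterate G (suc n) t₀ ≡ y) (length-take-≤ j rest (<⇒≤ j<|rest|))
                 (iterate-along (take j rest) [] (cong (t₀ ∷_) rest≡))

  G-closed : ∀ {v} → v ∈ T → G v ∈ T
  G-closed v∈T with ∈-∃++ v∈T
  ... | xs , []     , eq = subst (_∈ T) (sym (G-last xs eq)) (here refl)
  ... | xs , y ∷ ys , eq = subst (_∈ T) (sym (G-next xs eq)) (subst (y ∈_) (sym eq) (∈-++⁺ʳ xs (there (here refl))))

  iterate-closed : ∀ j {v} → v ∈ T → iterate G j v ∈ T
  iterate-closed zero    v∈T = v∈T
  iterate-closed (suc j) v∈T = G-closed (iterate-closed j v∈T)

  periodic-on-T : ∀ {v} → v ∈ T → iterate G k v ≡ v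
  periodic-on-T {v} v∈T with ∈-∃++ v∈T
  ... | xs , ys , eq = begin
    iterate G k v                              ≡⟨ cong (iterate G k) (iterate-t₀ xs eq) ⟨
    iterate G k (iterate G (length xs) t₀)     ≡⟨ iterate-comm G k (length xs) t₀ ⟩
    iterate G (length xs) (iterate G k t₀)     ≡⟨ cong (iterate G (length xs)) t₀-periodic ⟩
    iterate G (length xs) t₀                   ≡⟨ iterate-t₀ xs eq ⟩
    v                                          ∎
    where open ≡-Reasoning

module ShiftRegister (p m : ℕ) where

  open Words p

  State : Set
  State = Word (suc m)

  _≟S_ : DecidableEquality State
  _≟S_ = ≡-dec Fin._≟_

  open Walks (≡-dec {n = m} Fin._≟_) _≟S_ tail init
  open DecMembership _≟S_ using (_∈?_)

  after : State → List State → Maybe State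
  after v []       = nothing
  after v (a ∷ xs) = if does (v ≟S a) then List.head xs else after v xs

  after-∉ : ∀ {v} xs → v ∉ xs → after v xs ≡ nothing
  after-∉ []       _   = refl
  after-∉ {v} (a ∷ xs) v∉ rewrite dec-false (v ≟S a) (v∉ ∘ here) = after-∉ xs (v∉ ∘ there)

  after-∈ : ∀ xs {a b ys} → a ∉ xs → after a (xs ++ a ∷ b ∷ ys) ≡ just b
  after-∈ []       {a} _  rewrite dec-true (a ≟S a) refl = refl
  after-∈ (x ∷ xs) {a} a∉ rewrite dec-false (a ≟S x) (a∉ ∘ here) = after-∈ xs (a∉ ∘ there)

  repeatHead : State → State
  repeatHead v = head v ∷ init v

  lookup-init : ∀ {n} {A : Set} (w : Vec A (suc n)) i → lookup (init w) i ≡ lookup w (inject₁ i)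
  lookup-init (x ∷ y ∷ ys) Fin.zero    = refl
  lookup-init (x ∷ y ∷ ys) (Fin.suc i) = lookup-init (y ∷ ys) i

  lookup-repeatHead^ : ∀ j v (i : Fin (suc m)) → toℕ i ≤ j → lookup (iterate repeatHead j v) i ≡ head v
  lookup-repeatHead^ zero    (x ∷ _) Fin.zero    _ = refl
  lookup-repeatHead^ (suc j) v       Fin.zero    _ = trans (lookup-zero (iterate repeatHead j v)) (lookup-repeatHead^ j v Fin.zero z≤n)
    where
    lookup-zero : ∀ (w : State) → head w ≡ lookup w Fin.zero
    lookup-zero (_ ∷ _) = refl
  lookup-repeatHead^ (suc j) v       (Fin.suc i) (s≤s i≤j) =
    trans (lookup-init (iterate repeatHead j v) i)
          (lookup-repeatHead^ j v (inject₁ i) (subst (_≤ j) (sym (toℕ-inject₁ i)) i≤j))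

  repeatHead^-constant : ∀ j v → m ≤ j → iterate repeatHead j v ≡ Vec.replicate (suc m) (head v)
  repeatHead^-constant j v m≤j = begin
    iterate repeatHead j v                                  ≡⟨ tabulate∘lookup _ ⟨
    Vec.tabulate (lookup (iterate repeatHead j v))          ≡⟨ tabulate-cong (λ i → lookup-repeatHead^ j v i (≤-trans (toℕ≤pred[n] i) m≤j)) ⟩
    Vec.tabulate (λ _ → head v)                             ≡⟨ tabulate-cong (λ i → sym (lookup-replicate i (head v))) ⟩
    Vec.tabulate (lookup (Vec.replicate (suc m) (head v)))  ≡⟨ tabulate∘lookup _ ⟩
    Vec.replicate (suc m) (head v)                          ∎
    where open ≡-Reasoning

  repeatHead-replicate : ∀ c → repeatHead (Vec.replicate (suc m) c) ≡ Vec.replicate (suc m) c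
  repeatHead-replicate c = cong (c ∷_) (init-replicate m c)

  module FromClosedTrail {w₀ t₀ rest} (trail : ClosedTrail w₀ (t₀ ∷ rest)) where

    private
      T : List State
      T = t₀ ∷ rest

    -- Only the first letter depends on the trail; the others are shifted, so every node but the first
    -- copies a single neighbour.
    step : State → State
    step v = maybe head (head v) (after v (T ++ [ t₀ ])) ∷ init v

    step-off : ∀ {v} → v ∉ T → step v ≡ repeatHead v
    step-off {v} v∉T rewrite after-∉ (T ++ [ t₀ ]) ([ v∉T , (λ { (here refl) → v∉T (here refl) }) ]′ ∘ ∈-++⁻ T) = refl

    step-to : ∀ {a b} → after a (T ++ [ t₀ ]) ≡ just b → tail b ≡ init a → step a ≡ b
    step-to {a} {b ∷ bs} eq tb rewrite eq = cong (b ∷_) (sym tb)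

    step-next : ∀ xs {a b ys} → T ≡ xs ++ a ∷ b ∷ ys → step a ≡ b
    step-next xs {a} {b} {ys} eq = step-to after≡ tail-b
      where
      after≡ : after a (T ++ [ t₀ ]) ≡ just b
      after≡ = begin
        after a (T ++ [ t₀ ])                    ≡⟨ cong (λ zs → after a (zs ++ [ t₀ ])) eq ⟩
        after a ((xs ++ a ∷ b ∷ ys) ++ [ t₀ ])   ≡⟨ cong (after a) (++-assoc xs (a ∷ b ∷ ys) [ t₀ ]) ⟩
        after a (xs ++ a ∷ b ∷ ys ++ [ t₀ ])     ≡⟨ after-∈ xs (Unique-middle⇒∉ xs (subst Unique eq (proj₂ trail))) ⟩
        just b                                   ∎
        where open ≡-Reasoning
      tail-b : tail b ≡ init a
      tail-b with walk-split xs (subst (λ Z → Walk w₀ Z w₀) eq (proj₁ trail))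
      ... | _ , _ , (_ , tb , _) = tb

    step-last : ∀ xs {a} → T ≡ xs ++ [ a ] → step a ≡ t₀
    step-last xs {a} eq = step-to after≡ tail-t₀
      where
      after≡ : after a (T ++ [ t₀ ]) ≡ just t₀
      after≡ = begin
        after a (T ++ [ t₀ ])                ≡⟨ cong (λ zs → after a (zs ++ [ t₀ ])) eq ⟩
        after a ((xs ++ [ a ]) ++ [ t₀ ])    ≡⟨ cong (after a) (++-assoc xs [ a ] [ t₀ ]) ⟩
        after a (xs ++ a ∷ t₀ ∷ [])          ≡⟨ after-∈ xs (Unique-middle⇒∉ xs (subst Unique eq (proj₂ trail))) ⟩
        just t₀                              ∎
        where open ≡-Reasoning
      tail-t₀ : tail t₀ ≡ init a
      tail-t₀ with walk-split xs (subst (λ Z → Walk w₀ Z w₀) eq (proj₁ trail))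
      ... | _ , _ , (_ , init-a≡w₀) = trans (proj₁ (proj₁ trail)) (sym init-a≡w₀)

    open CyclicOrbit step t₀ rest (proj₂ trail) step-next step-last public

    periodic-off-trail-fixed : ∀ {v n} → v ∉ T → iterate step (suc n) v ≡ v → step v ≡ v
    periodic-off-trail-fixed {v} {n} v∉T per = begin
      step v                              ≡⟨ step-off v∉T ⟩
      repeatHead v                        ≡⟨ cong repeatHead v-constant ⟩
      repeatHead (Vec.replicate (suc m) (head v))   ≡⟨ repeatHead-replicate (head v) ⟩
      Vec.replicate (suc m) (head v)                ≡⟨ v-constant ⟨
      v                                   ∎
      where
      open ≡-Reasoning
      orbit-off : ∀ j → iterate step j v ∉ T
      orbit-off j inT = v∉T (subst (_∈ T) back (iterate-closed (j * suc n ∸ j) inT))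
        where
        back : iterate step (j * suc n ∸ j) (iterate step j v) ≡ v
        back = trans (sym (iterate-+ step (j * suc n ∸ j) j v))
                 (trans (cong (λ i → iterate step i v) (m∸n+n≡m (m≤m*n j (suc n)))) (iterate-periodic step j per))
      step^≡repeatHead^ : ∀ j → iterate step j v ≡ iterate repeatHead j v
      step^≡repeatHead^ zero    = refl
      step^≡repeatHead^ (suc j) = trans (step-off (orbit-off j)) (cong repeatHead (step^≡repeatHead^ j))
      v-constant : v ≡ Vec.replicate (suc m) (head v)
      v-constant = trans (sym (iterate-periodic step {suc n} (suc m) per))
        (trans (step^≡repeatHead^ (suc m * suc n)) (repeatHead^-constant _ v (≤-trans (n≤1+n m) (m≤m*n (suc m) (suc n)))))

    network : AutomataNetwork q (suc m)
    network x = lookup (step (Vec.tabulate x))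

    iterate-network : ∀ j w → iterate network j (lookup w) ≡ lookup (iterate step j w)
    iterate-network = iterate-conjugate lookup (λ w → cong (lookup ∘ step) (tabulate∘lookup w))

    lookup-injective : ∀ {w w′ : State} → lookup w ≡ lookup w′ → w ≡ w′
    lookup-injective {w} {w′} eq = trans (sym (tabulate∘lookup w)) (trans (cong Vec.tabulate eq) (tabulate∘lookup w′))

    period-network : ∀ {j w} → iterate step j w ≡ w → iterate network j (lookup w) ≡ lookup w
    period-network {j} {w} per = trans (iterate-network j w) (cong lookup per)

    network-shift : ∀ x j → network x (Fin.suc j) ≡ x (inject₁ j)
    network-shift x j = trans (lookup-init (Vec.tabulate x) j) (lookup∘tabulate x (inject₁ j))

    update-≢ : ∀ (x : Config q (suc m)) i a j → j ≢ i → update x i a j ≡ x j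
    update-≢ x i a j j≢i with j Fin.≟ i
    ... | yes j≡i = ⊥-elim (j≢i j≡i)
    ... | no  _   = refl

    arc-into-suc : ∀ {i j} → Arc network i (Fin.suc j) → i ≡ inject₁ j
    arc-into-suc {i} {j} (x , a , differ) with i Fin.≟ inject₁ j
    ... | yes i≡ = i≡
    ... | no  i≢ = ⊥-elim (differ (begin
      network x (Fin.suc j)              ≡⟨ network-shift x j ⟩
      x (inject₁ j)                      ≡⟨ update-≢ x i a (inject₁ j) (i≢ ∘ sym) ⟨
      update x i a (inject₁ j)           ≡⟨ network-shift (update x i a) j ⟨
      network (update x i a) (Fin.suc j) ∎))
      where open ≡-Reasoning

    almostDegree1 : AlmostDegree1 network
    almostDegree1 = inj₂ (Fin.zero , λ
      { Fin.zero    0≢0 → ⊥-elim (0≢0 refl)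
      ; (Fin.suc j) _ i i′ arc arc′ → trans (arc-into-suc arc) (sym (arc-into-suc arc′)) })

    t₀-cycle : OnLimitCycleOfLength network (lookup t₀) k
    t₀-cycle = s≤s z≤n , period-network {k} t₀-periodic ,
      λ j 1≤j j<k eq → t₀-minimal j 1≤j j<k (lookup-injective (trans (sym (iterate-network j t₀)) eq))

    cycle-through≤k : ∀ {n} w → OnLimitCycleOfLength network (lookup w) (suc n) → suc n ≤ k
    cycle-through≤k {n} w cyc with w ∈? T
    ... | yes w∈T = period≤ cyc (s≤s z≤n) (period-network {k} (periodic-on-T w∈T))
    ... | no  w∉T = ≤-trans (period≤ cyc ≤-refl (period-network {1} (periodic-off-trail-fixed {n = n} w∉T w-periodic))) (s≤s z≤n)
      where
      w-periodic : iterate step (suc n) w ≡ w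
      w-periodic = lookup-injective (trans (sym (iterate-network (suc n) w)) (proj₁ (proj₂ cyc)))

    cycle≤k : ∀ y n → OnLimitCycleOfLength network y n → n ≤ k
    cycle≤k y zero    (() , _)
    cycle≤k y (suc n) cyc@(_ , per , _) =
      cycle-through≤k (step (Vec.tabulate (iterate network n y))) (subst (λ z → OnLimitCycleOfLength network z (suc n)) (sym per) cyc)

    longest : LongestLimitCycleLength network k
    longest = (lookup t₀ , t₀-cycle) , cycle≤k

-- The de Bruijn graph and its lifts

module Order (p m : ℕ) where

  open Words p

  -- An edge x₀ x₁ … xₘ goes from its tail x₁ … xₘ to its init x₀ … xₘ₋₁.
  Vertex Edge : Set
  Vertex = Word m
  Edge   = Word (suc m)

  _≟V_ : DecidableEquality Vertex
  _≟V_ = ≡-dec Fin._≟_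

  _≟E_ : DecidableEquality Edge
  _≟E_ = ≡-dec Fin._≟_

  open Walks _≟V_ _≟E_ tail init public

  lastSum : List Edge → Letter
  lastSum []       = 𝟘
  lastSum (e ∷ es) = last e ⊕ lastSum es

  lastSum-++ : ∀ xs ys → lastSum (xs ++ ys) ≡ lastSum xs ⊕ lastSum ys
  lastSum-++ []       ys = sym (⊕-identityˡ (lastSum ys))
  lastSum-++ (x ∷ xs) ys = trans (cong (last x ⊕_) (lastSum-++ xs ys)) (sym (⊕-assoc (last x) (lastSum xs) (lastSum ys)))

  lastSum-replicate : ∀ n e → lastSum (replicate n e) ≡ n · last e
  lastSum-replicate zero    e = refl
  lastSum-replicate (suc n) e = cong (last e ⊕_) (lastSum-replicate n e)

  repeat : ℕ → List Edge → List Edge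
  repeat zero    Z = []
  repeat (suc t) Z = Z ++ repeat t Z

  lastSum-repeat : ∀ t Z → lastSum (repeat t Z) ≡ t · lastSum Z
  lastSum-repeat zero    Z = refl
  lastSum-repeat (suc t) Z = trans (lastSum-++ Z (repeat t Z)) (cong (lastSum Z ⊕_) (lastSum-repeat t Z))

  walk-repeat : ∀ t {x} Z → Walk x Z x → Walk x (repeat t Z) x
  walk-repeat zero    Z c = refl
  walk-repeat (suc t) Z c = walk-++ Z c (walk-repeat t Z c)

  repeat-⊆ : ∀ t Z → repeat t Z ⊆ Z
  repeat-⊆ (suc t) Z e∈ = [ id , repeat-⊆ t Z ]′ (∈-++⁻ Z e∈)

  -- Lifts along D of a closed walk of letter-sum 𝟘 are closed, and as the length is ≡ 1 (mod q), stated
  -- as n · a ≡ a, the start letter of a lift adds itself to the letter-sum.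
  record SumWalk (rest : List Edge) (s : Letter) : Set where
    field
      start          : Vertex
      edges          : List Edge
      closed         : Walk start edges start
      edges⊆rest     : edges ⊆ rest
      length≡1-mod-q : ∀ a → length edges · a ≡ a
      lastSum≡s      : lastSum edges ≡ s

  record Liftable (rest : List Edge) : Set where
    field
      trail : ClosedTrail 𝟎 (𝟎 ∷ rest)
      walk₀ : SumWalk rest 𝟘
      walk₁ : SumWalk rest 𝟙

module LineGraph (p m : ℕ) where

  open Words p
  module O₁ = Order p m
  module O₂ = Order p (suc m)

  lineLift : O₁.Edge → List O₁.Edge → List O₂.Edge
  lineLift prev []       = []
  lineLift prev (t ∷ ts) = (head t ∷ prev) ∷ lineLift t ts

  lastOf : O₁.Edge → List O₁.Edge → O₁.Edge
  lastOf x []       = x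
  lastOf x (y ∷ ys) = lastOf y ys

  init-lineEdge : ∀ {prev t : O₁.Edge} → tail t ≡ init prev → init (head t ∷ prev) ≡ t
  init-lineEdge {prev} {t ∷ ts} tail≡ = trans (init-∷ t prev) (cong (t ∷_) (sym tail≡))

  walk-lineLift : ∀ prev ts {v} → O₁.Walk (init prev) ts v → O₂.Walk prev (lineLift prev ts) (lastOf prev ts)
  walk-lineLift prev []       _          = refl
  walk-lineLift prev (t ∷ ts) (st , w) =
    refl , subst (λ x → O₂.Walk x (lineLift t ts) (lastOf t ts)) (sym (init-lineEdge st)) (walk-lineLift t ts w)

  map-init-lineLift : ∀ prev ts {v} → O₁.Walk (init prev) ts v → map init (lineLift prev ts) ≡ ts
  map-init-lineLift prev []       _        = refl
  map-init-lineLift prev (t ∷ ts) (st , w) = cong₂ _∷_ (init-lineEdge st) (map-init-lineLift t ts w)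

  length-lineLift : ∀ prev ts → length (lineLift prev ts) ≡ length ts
  length-lineLift prev []       = refl
  length-lineLift prev (t ∷ ts) = cong suc (length-lineLift t ts)

  init-lastOf : ∀ {u v} t ts → O₁.Walk u (t ∷ ts) v → init (lastOf t ts) ≡ v
  init-lastOf t []        (_ , w) = w
  init-lastOf t (t′ ∷ ts) (_ , w) = init-lastOf t′ ts w

  closedTrail-lineLift : ∀ {w t₀ rest} → O₁.ClosedTrail w (t₀ ∷ rest) →
    ∃ λ T′ → ∃ λ w′ → O₂.ClosedTrail w′ T′ × length T′ ≡ suc (length rest)
  closedTrail-lineLift {w} {t₀} {rest} (c , u) =
    lineLift prev T , prev , (walk-lineLift prev T c′ , map⁻ (subst Unique (sym (map-init-lineLift prev T c′)) u)) ,
    length-lineLift prev T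
    where
    open import Data.List.Relation.Unary.Unique.Propositional using (Unique)
    T = t₀ ∷ rest
    prev = lastOf t₀ rest
    c′ : O₁.Walk (init prev) T w
    c′ = subst (λ z → O₁.Walk z T w) (sym (init-lastOf t₀ rest c)) c

module Integration (p m : ℕ) where

  open Words p
  module O₁ = Order p m
  module O₂ = Order p (suc m)
  open O₁ using (lastSum)

  liftWalk : Letter → List O₁.Edge → List O₂.Edge
  liftWalk c []       = []
  liftWalk c (e ∷ es) = integrate c e ∷ liftWalk (c ⊕ last e) es

  walk-liftWalk : ∀ {u v} c es → O₁.Walk u es v →
                  O₂.Walk (integrate c u) (liftWalk c es) (integrate (c ⊕ lastSum es) v)
  walk-liftWalk c []       refl     = cong (λ b → integrate b _) (sym (⊕-identityʳ c))
  walk-liftWalk {u} {v} c (e ∷ es) (tail-e , w) =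
    trans (tail-integrate c e) (cong (integrate c) tail-e) ,
    subst₂ (λ x b → O₂.Walk x (liftWalk (c ⊕ last e) es) (integrate b v))
      (sym (init-integrate c e)) (⊕-assoc c (last e) (lastSum es))
      (walk-liftWalk (c ⊕ last e) es w)

  length-liftWalk : ∀ c es → length (liftWalk c es) ≡ length es
  length-liftWalk c []       = refl
  length-liftWalk c (e ∷ es) = cong suc (length-liftWalk _ es)

  ∈-liftWalk⁻ : ∀ c es {z} → z ∈ liftWalk c es → ∃ λ b → ∃ λ e → e ∈ es × z ≡ integrate b e
  ∈-liftWalk⁻ c (e ∷ es) (here refl) = c , e , here refl , refl
  ∈-liftWalk⁻ c (e ∷ es) (there z∈)  = let b , e′ , e′∈ , eq = ∈-liftWalk⁻ _ es z∈ in b , e′ , there e′∈ , eq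

  lastSum-liftWalk : ∀ c d es → O₂.lastSum (liftWalk (c ⊕ d) es) ≡ length es · d ⊕ O₂.lastSum (liftWalk c es)
  lastSum-liftWalk c d []       = sym (⊕-identityʳ 𝟘)
  lastSum-liftWalk c d (e ∷ es) = begin
    last (integrate (c ⊕ d) e) ⊕ O₂.lastSum (liftWalk ((c ⊕ d) ⊕ last e) es)
      ≡⟨ cong₂ _⊕_ (last-integrate (c ⊕ d) e) (cong (λ b → O₂.lastSum (liftWalk b es)) (⊕-exchangeʳ c d (last e))) ⟩
    (c ⊕ d) ⊕ O₂.lastSum (liftWalk ((c ⊕ last e) ⊕ d) es)
      ≡⟨ cong ((c ⊕ d) ⊕_) (lastSum-liftWalk (c ⊕ last e) d es) ⟩
    (c ⊕ d) ⊕ (length es · d ⊕ O₂.lastSum (liftWalk (c ⊕ last e) es))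
      ≡⟨ trans (cong (_⊕ (length es · d ⊕ Y)) (⊕-comm c d)) (⊕-interchange d c (length es · d) Y) ⟩
    (d ⊕ length es · d) ⊕ (c ⊕ O₂.lastSum (liftWalk (c ⊕ last e) es))
      ≡⟨ cong (λ b → (d ⊕ length es · d) ⊕ (b ⊕ Y)) (sym (last-integrate c e)) ⟩
    length (e ∷ es) · d ⊕ O₂.lastSum (liftWalk c (e ∷ es))  ∎
    where
    open ≡-Reasoning
    Y = O₂.lastSum (liftWalk (c ⊕ last e) es)

  allLetters : List Letter
  allLetters = allFin q

  fullPreimage : O₁.Edge → List O₂.Edge
  fullPreimage v = map (λ b → integrate b v) allLetters

  D-fullPreimage : ∀ {v z} → z ∈ fullPreimage v → D z ≡ v
  D-fullPreimage {v} z∈ = let b , _ , z≡ = ∈-map⁻ (λ b → integrate b v) z∈ in trans (cong D z≡) (D-integrate b v)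

  Unique-fullPreimage : ∀ v → Unique (fullPreimage v)
  Unique-fullPreimage v = map⁺ (λ {b} {b′} eq → proj₁ (integrate-injective {b = b} {b′} {v} {v} eq)) (allFin⁺ q)

  length-fullPreimage : ∀ v → length (fullPreimage v) ≡ q
  length-fullPreimage v = trans (length-map _ allLetters) (length-tabulate {n = q} (λ i → i))

  integrate-∈-fullPreimage : ∀ b v → integrate b v ∈ fullPreimage v
  integrate-∈-fullPreimage b v = ∈-map⁺ (λ b → integrate b v) (∈-allFin b)

  count-integrate : ∀ l (w : O₁.Vertex) (u : O₂.Vertex) →
    count (λ b → does (integrate (b ⊕ l) w O₂.≟V u)) allLetters ≡ O₁.[ w ≟ D u ]
  count-integrate l w u with w O₁.≟V D u
  ... | yes w≡Du = trans (count-cong allLetters λ {b} _ →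
                             does-⇔ (mk⇔ (to b) (from b)) (integrate (b ⊕ l) w O₂.≟V u) (b Fin.≟ (last u ⊝ l)))
                         (count-≟-unique Fin._≟_ (allFin⁺ q) (∈-allFin (last u ⊝ l)))
    where
    to : ∀ b → integrate (b ⊕ l) w ≡ u → b ≡ last u ⊝ l
    to b eq = trans (sym (⊕-⊝ b l)) (cong (_⊝ l) (trans (sym (last-integrate (b ⊕ l) w)) (cong last eq)))
    from : ∀ b → b ≡ last u ⊝ l → integrate (b ⊕ l) w ≡ u
    from b refl = trans (cong₂ integrate (⊝-⊕ (last u) l) w≡Du) (integrate-D u)
  ... | no w≢Du = count-false allLetters (λ {b} _ →
                    dec-false (integrate (b ⊕ l) w O₂.≟V u) (λ eq → w≢Du (trans (sym (D-integrate (b ⊕ l) w)) (cong D eq))))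

  outDeg-fullPreimage : ∀ v u → O₂.outDeg (fullPreimage v) u ≡ O₁.[ tail v ≟ D u ]
  outDeg-fullPreimage v u = begin
    O₂.outDeg (fullPreimage v) u
      ≡⟨ count-map (λ e → does (tail e O₂.≟V u)) (λ b → integrate b v) allLetters ⟩
    count (λ b → does (tail (integrate b v) O₂.≟V u)) allLetters
      ≡⟨ count-cong allLetters (λ {b} _ → cong (λ x → does (x O₂.≟V u))
           (trans (tail-integrate b v) (cong (λ c → integrate c (tail v)) (sym (⊕-identityʳ b))))) ⟩
    count (λ b → does (integrate (b ⊕ 𝟘) (tail v) O₂.≟V u)) allLetters ≡⟨ count-integrate 𝟘 (tail v) u ⟩
    O₁.[ tail v ≟ D u ]                                             ∎
    where open ≡-Reasoning

  inDeg-fullPreimage : ∀ v u → O₂.inDeg (fullPreimage v) u ≡ O₁.[ init v ≟ D u ]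
  inDeg-fullPreimage v u = begin
    O₂.inDeg (fullPreimage v) u
      ≡⟨ count-map (λ e → does (init e O₂.≟V u)) (λ b → integrate b v) allLetters ⟩
    count (λ b → does (init (integrate b v) O₂.≟V u)) allLetters
      ≡⟨ count-cong allLetters (λ {b} _ → cong (λ x → does (x O₂.≟V u)) (init-integrate b v)) ⟩
    count (λ b → does (integrate (b ⊕ last v) (init v) O₂.≟V u)) allLetters ≡⟨ count-integrate (last v) (init v) u ⟩
    O₁.[ init v ≟ D u ]                                             ∎
    where open ≡-Reasoning

  degrees-concatMap-fullPreimage : ∀ vs u →
    O₂.outDeg (concatMap fullPreimage vs) u + O₁.inDeg vs (D u) ≡ O₂.inDeg (concatMap fullPreimage vs) u + O₁.outDeg vs (D u)
  degrees-concatMap-fullPreimage []       u = refl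
  degrees-concatMap-fullPreimage (v ∷ vs) u = begin
    O₂.outDeg (fullPreimage v ++ F) u + (O₁.[ init v ≟ D u ] + O₁.inDeg vs (D u))
      ≡⟨ cong (_+ (O₁.[ init v ≟ D u ] + O₁.inDeg vs (D u)))
              (trans (count-++ _ (fullPreimage v) F) (cong (_+ O₂.outDeg F u) (outDeg-fullPreimage v u))) ⟩
    (O₁.[ tail v ≟ D u ] + O₂.outDeg F u) + (O₁.[ init v ≟ D u ] + O₁.inDeg vs (D u))
      ≡⟨ interchange O₁.[ tail v ≟ D u ] (O₂.outDeg F u) O₁.[ init v ≟ D u ] (O₁.inDeg vs (D u)) ⟩
    (O₁.[ tail v ≟ D u ] + O₁.[ init v ≟ D u ]) + (O₂.outDeg F u + O₁.inDeg vs (D u))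
      ≡⟨ cong₂ _+_ (+-comm O₁.[ tail v ≟ D u ] O₁.[ init v ≟ D u ]) (degrees-concatMap-fullPreimage vs u) ⟩
    (O₁.[ init v ≟ D u ] + O₁.[ tail v ≟ D u ]) + (O₂.inDeg F u + O₁.outDeg vs (D u))
      ≡⟨ interchange O₁.[ init v ≟ D u ] O₁.[ tail v ≟ D u ] (O₂.inDeg F u) (O₁.outDeg vs (D u)) ⟩
    (O₁.[ init v ≟ D u ] + O₂.inDeg F u) + (O₁.[ tail v ≟ D u ] + O₁.outDeg vs (D u))
      ≡⟨ cong (_+ (O₁.[ tail v ≟ D u ] + O₁.outDeg vs (D u)))
              (trans (count-++ _ (fullPreimage v) F) (cong (_+ O₂.inDeg F u) (inDeg-fullPreimage v u))) ⟨
    O₂.inDeg (fullPreimage v ++ F) u + (O₁.[ tail v ≟ D u ] + O₁.outDeg vs (D u))  ∎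
    where
    open ≡-Reasoning
    F = concatMap fullPreimage vs

  Balanced-concatMap-fullPreimage : ∀ {vs} → O₁.Balanced vs → O₂.Balanced (concatMap fullPreimage vs)
  Balanced-concatMap-fullPreimage {vs} bal u =
    +-cancelʳ-≡ _ _ _ (trans (degrees-concatMap-fullPreimage vs u) (cong (O₂.inDeg (concatMap fullPreimage vs) u +_) (bal (D u))))

  module _ (r : ℕ) (r<q : r < q) where

    -- The loops at the constant words of the letters 1, …, r are left out.
    keptLetters : List Letter
    keptLetters = 𝟘 ∷ drop (suc r) allLetters

    zeroLoops : List O₂.Edge
    zeroLoops = map (λ b → integrate b 𝟎) keptLetters

    Preimage : List O₁.Edge → List O₂.Edge
    Preimage rest = zeroLoops ++ concatMap fullPreimage rest

    Unique-Preimage : ∀ {rest} → Unique (𝟎 ∷ rest) → Unique (Preimage rest)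
    Unique-Preimage {rest} (𝟎∉rest ∷ u-rest) =
      ++⁺ (map⁺ (λ {b} {b′} eq → proj₁ (integrate-injective {b = b} {b′} {𝟎} {𝟎} eq)) unique-kept)
          (Unique-concatMap⁺ D D-fullPreimage (λ {v} _ → Unique-fullPreimage v) u-rest) disjoint
      where
      unique-kept : Unique keptLetters
      unique-kept with allFin⁺ q
      ... | 𝟘≢ ∷ u = AllP.drop⁺ r 𝟘≢ ∷ drop⁺ r u
      disjoint : ∀ {z} → ¬ (z ∈ zeroLoops × z ∈ concatMap fullPreimage rest)
      disjoint (z∈loops , z∈full) =
        let b , _ , z≡ = ∈-map⁻ (λ b → integrate b 𝟎) z∈loops
            v , v∈rest , z∈v = find (∈-concatMap⁻ fullPreimage {xs = rest} z∈full) in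
        All.lookup 𝟎∉rest v∈rest (trans (sym (D-integrate b 𝟎)) (trans (cong D (sym z≡)) (D-fullPreimage z∈v)))

    length-concatMap-fullPreimage : ∀ vs → length (concatMap fullPreimage vs) ≡ q * length vs
    length-concatMap-fullPreimage []       = sym (*-zeroʳ q)
    length-concatMap-fullPreimage (v ∷ vs) = begin
      length (fullPreimage v ++ concatMap fullPreimage vs)  ≡⟨ length-++ (fullPreimage v) ⟩
      length (fullPreimage v) + length (concatMap fullPreimage vs)
        ≡⟨ cong₂ _+_ (length-fullPreimage v) (length-concatMap-fullPreimage vs) ⟩
      q + q * length vs                                      ≡⟨ *-suc q (length vs) ⟨
      q * suc (length vs)                                    ∎
      where open ≡-Reasoning

    length-zeroLoops : length zeroLoops + r ≡ q
    length-zeroLoops = begin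
      length zeroLoops + r                           ≡⟨ cong (_+ r) (length-map _ keptLetters) ⟩
      suc (length (drop r nonzero)) + r              ≡⟨ cong (λ n → suc n + r) (length-drop r nonzero) ⟩
      suc (length nonzero ∸ r) + r                   ≡⟨ cong (λ n → suc (n ∸ r) + r) (length-tabulate {n = suc p} Fin.suc) ⟩
      suc (suc p ∸ r + r)                            ≡⟨ cong suc (m∸n+n≡m (≤-pred r<q)) ⟩
      q                                              ∎
      where
      open ≡-Reasoning
      nonzero = tabulate {n = suc p} Fin.suc

    length-Preimage : ∀ rest → length (Preimage rest) + r ≡ q * suc (length rest)
    length-Preimage rest = begin
      length (zeroLoops ++ full) + r                 ≡⟨ cong (_+ r) (length-++ zeroLoops) ⟩
      length zeroLoops + length full + r             ≡⟨ xy∙z≈xz∙y (length zeroLoops) (length full) r ⟩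
      length zeroLoops + r + length full             ≡⟨ cong₂ _+_ length-zeroLoops (length-concatMap-fullPreimage rest) ⟩
      q + q * length rest                            ≡⟨ *-suc q (length rest) ⟨
      q * suc (length rest)                          ∎
      where
      open ≡-Reasoning
      full = concatMap fullPreimage rest

    Balanced-Preimage : ∀ {rest} → O₁.Balanced rest → O₂.Balanced (Preimage rest)
    Balanced-Preimage {rest} bal =
      O₂.Balanced-++ {zeroLoops} (O₂.Balanced-loops {zeroLoops} loop) (Balanced-concatMap-fullPreimage {rest} bal)
      where
      loop : ∀ {e} → e ∈ zeroLoops → tail e ≡ init e
      loop e∈ with ∈-map⁻ (λ b → integrate b 𝟎) e∈
      ... | b , _ , refl = trans (cong tail (integrate-𝟎 b)) (sym (trans (cong init (integrate-𝟎 b)) (init-replicate (suc m) b)))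

    module Lift {rest} (L : O₁.Liftable rest) where

      open O₁.Liftable L

      S : List O₂.Edge
      S = Preimage rest

      e₀ : O₂.Edge
      e₀ = integrate 𝟘 𝟎

      𝟎∉rest : 𝟎 ∉ rest
      𝟎∉rest = Unique[x∷xs]⇒x∉xs (proj₂ trail)

      walk-rest : O₁.Walk 𝟎 rest 𝟎
      walk-rest = subst (λ x → O₁.Walk x rest 𝟎) (init-replicate m 𝟘) (proj₂ (proj₁ trail))

      prefix : ∀ {v} → v ∈ rest → ∃ λ as → ∃ λ bs → rest ≡ as ++ v ∷ bs × O₁.Walk 𝟎 as (tail v) × O₁.Walk (tail v) (v ∷ bs) 𝟎
      prefix v∈ with ∈-∃++ v∈
      ... | as , bs , refl with O₁.walk-split as walk-rest
      ...   | _ , w₁ , (tv , w₂) = as , bs , refl , subst (O₁.Walk 𝟎 as) (sym tv) w₁ , (refl , w₂)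

      liftWalk-⊆ : ∀ c {es} → es ⊆ rest → liftWalk c es ⊆ S
      liftWalk-⊆ c {es} es⊆rest z∈ with ∈-liftWalk⁻ c es z∈
      ... | b , e , e∈es , refl = ∈-++⁺ʳ zeroLoops (∈-concatMap⁺ fullPreimage (lose (es⊆rest e∈es) (integrate-∈-fullPreimage b e)))

      -- Along the trail to the walk of sum 𝟙, t times around it and back: a closed walk of letter-sum A + t,
      -- whose lift moves from the zero loop to the loop at the constant word c.
      reach-zeroLoop : ∀ c → O₂.Reaches S (integrate 𝟘 𝟎) (integrate c 𝟎)
      reach-zeroLoop c
        with O₁.SumWalk.edges walk₁ | O₁.SumWalk.closed walk₁ | O₁.SumWalk.edges⊆rest walk₁ | O₁.SumWalk.lastSum≡s walk₁
      ... | []     | _                 | _      | ()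
      ... | g ∷ zs | (tail-g , zs-walk) | Z⊆rest | sum≡𝟙 with prefix (Z⊆rest (here refl))
      ...   | as , bs , rest≡ , walk-as , walk-gbs = liftWalk 𝟘 P , walk-lifted , liftWalk-⊆ 𝟘 P⊆rest
        where
        Z = g ∷ zs
        A = lastSum as ⊕ lastSum (g ∷ bs)
        t = toℕ (c ⊝ A)
        P = as ++ O₁.repeat t Z ++ g ∷ bs
        Z-closed : O₁.Walk (tail g) Z (tail g)
        Z-closed = subst (λ x → O₁.Walk x Z x) (sym tail-g) (tail-g , zs-walk)
        walk-P : O₁.Walk 𝟎 P 𝟎
        walk-P = O₁.walk-++ as walk-as (O₁.walk-++ (O₁.repeat t Z) (O₁.walk-repeat t Z Z-closed) walk-gbs)
        lastSum-P : lastSum P ≡ c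
        lastSum-P = begin
          lastSum P                                         ≡⟨ O₁.lastSum-++ as _ ⟩
          lastSum as ⊕ lastSum (O₁.repeat t Z ++ g ∷ bs)    ≡⟨ cong (lastSum as ⊕_) (O₁.lastSum-++ (O₁.repeat t Z) (g ∷ bs)) ⟩
          lastSum as ⊕ (lastSum (O₁.repeat t Z) ⊕ lastSum (g ∷ bs))
            ≡⟨ cong (λ x → lastSum as ⊕ (x ⊕ lastSum (g ∷ bs))) (trans (O₁.lastSum-repeat t Z) (cong (t ·_) sum≡𝟙)) ⟩
          lastSum as ⊕ (t · 𝟙 ⊕ lastSum (g ∷ bs))           ≡⟨ cong (lastSum as ⊕_) (⊕-comm (t · 𝟙) (lastSum (g ∷ bs))) ⟩
          lastSum as ⊕ (lastSum (g ∷ bs) ⊕ t · 𝟙)           ≡⟨ ⊕-assoc (lastSum as) (lastSum (g ∷ bs)) (t · 𝟙) ⟨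
          A ⊕ t · 𝟙                                          ≡⟨ cong (A ⊕_) (toℕ[c]·𝟙≡c (c ⊝ A)) ⟩
          A ⊕ (c ⊝ A)                                        ≡⟨ ⊕-⊝-cancel A c ⟩
          c                                                  ∎
          where open ≡-Reasoning
        walk-lifted : O₂.Walk (integrate 𝟘 𝟎) (liftWalk 𝟘 P) (integrate c 𝟎)
        walk-lifted = subst (λ b → O₂.Walk (integrate 𝟘 𝟎) (liftWalk 𝟘 P) (integrate b 𝟎))
                        (trans (⊕-identityˡ (lastSum P)) lastSum-P) (walk-liftWalk 𝟘 P walk-P)
        P⊆rest : P ⊆ rest
        P⊆rest = [ in-rest ∘ ∈-++⁺ˡ , [ Z⊆rest ∘ O₁.repeat-⊆ t Z , in-rest ∘ ∈-++⁺ʳ as ]′ ∘ ∈-++⁻ (O₁.repeat t Z) ]′ ∘ ∈-++⁻ as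
          where
          in-rest : ∀ {e} → e ∈ as ++ g ∷ bs → e ∈ rest
          in-rest = subst (_ ∈_) (sym rest≡)

      e₀∈S : e₀ ∈ S
      e₀∈S = ∈-++⁺ˡ {ys = concatMap fullPreimage rest} (here refl)

      connected : ∀ {z} → z ∈ S → O₂.Reaches S (tail e₀) (tail z)
      connected z∈S with ∈-++⁻ zeroLoops z∈S
      ... | inj₁ z∈loops with ∈-map⁻ (λ b → integrate b 𝟎) z∈loops
      ...   | b , _ , refl = reach-zeroLoop b
      connected z∈S | inj₂ z∈full with find (∈-concatMap⁻ fullPreimage {xs = rest} z∈full)
      ...   | v , v∈rest , z∈v with ∈-map⁻ (λ b → integrate b v) z∈v | prefix v∈rest
      ...     | b , _ , refl | as , bs , rest≡ , walk-as , _ =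
        O₂.reaches-trans (reach-zeroLoop c) (liftWalk c as , walk-lifted , liftWalk-⊆ c (subst (_ ∈_) (sym rest≡) ∘ ∈-++⁺ˡ))
        where
        c = b ⊝ lastSum as
        walk-lifted : O₂.Walk (integrate c 𝟎) (liftWalk c as) (tail (integrate b v))
        walk-lifted = subst (O₂.Walk (integrate c 𝟎) (liftWalk c as))
                        (trans (cong (λ x → integrate x (tail v)) (⊝-⊕ b (lastSum as))) (sym (tail-integrate b v)))
                        (walk-liftWalk c as walk-as)

      -- Both walks one order up are lifts of walk₀.
      liftSumWalk : ∀ {rest′} → S ⊆ 𝟎 ∷ rest′ → ∀ s → O₂.SumWalk rest′ s
      liftSumWalk {rest′} S⊆ s = record
        { start          = integrate c x
        ; edges          = liftWalk c Z
        ; closed         = subst (λ b → O₂.Walk (integrate c x) (liftWalk c Z) (integrate b x))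
                             (trans (cong (c ⊕_) sum≡𝟘) (⊕-identityʳ c)) (walk-liftWalk c Z closed)
        ; edges⊆rest     = edges⊆rest′
        ; length≡1-mod-q = λ a → trans (cong (_· a) (length-liftWalk c Z)) (length≡1-mod-q a)
        ; lastSum≡s      = begin
            O₂.lastSum (liftWalk c Z)            ≡⟨ cong (λ b → O₂.lastSum (liftWalk b Z)) (⊕-identityˡ c) ⟨
            O₂.lastSum (liftWalk (𝟘 ⊕ c) Z)      ≡⟨ lastSum-liftWalk 𝟘 c Z ⟩
            length Z · c ⊕ σ₀                    ≡⟨ cong (_⊕ σ₀) (length≡1-mod-q c) ⟩
            c ⊕ σ₀                               ≡⟨ ⊝-⊕ s σ₀ ⟩
            s                                    ∎
        }
        where
        open ≡-Reasoning
        open O₁.SumWalk walk₀ renaming (start to x; edges to Z; lastSum≡s to sum≡𝟘)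
        σ₀ = O₂.lastSum (liftWalk 𝟘 Z)
        c = s ⊝ σ₀
        edges⊆rest′ : liftWalk c Z ⊆ rest′
        edges⊆rest′ z∈ with S⊆ (liftWalk-⊆ c edges⊆rest z∈) | ∈-liftWalk⁻ c Z z∈
        ... | there z∈rest′ | _ = z∈rest′
        ... | here z≡𝟎      | b , e , e∈Z , z≡ =
          ⊥-elim (𝟎∉rest (subst (_∈ rest) e≡𝟎 (edges⊆rest e∈Z)))
          where
          e≡𝟎 : e ≡ 𝟎
          e≡𝟎 = trans (sym (D-integrate b e)) (trans (cong D (trans (sym z≡) z≡𝟎)) (D-replicate (suc m) 𝟘))

      liftLiftable : ∃ λ rest′ → O₂.Liftable rest′ × suc (length rest′) + r ≡ q * suc (length rest)
      liftLiftable
        with O₂.eulerCircuit (Unique-Preimage (proj₂ trail)) (Balanced-Preimage {rest} (O₁.closedWalk⇒Balanced rest walk-rest))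
                             e₀∈S connected
      ... | T₂ , _ , circuit , T₂⊆S , S⊆T₂ with O₂.closedTrail-rotateTo circuit (S⊆T₂ e₀∈S)
      ...   | rest′ , trail′ , T₂⊆ , ⊆T₂ =
        rest′ ,
        record { trail = subst (λ e → O₂.ClosedTrail (tail e) (e ∷ rest′)) e₀≡𝟎 trail′
               ; walk₀ = liftSumWalk S⊆ 𝟘
               ; walk₁ = liftSumWalk S⊆ 𝟙 } ,
        trans (cong (_+ r) length≡) (length-Preimage rest)
        where
        e₀≡𝟎 : e₀ ≡ 𝟎
        e₀≡𝟎 = integrate-𝟎 𝟘
        S⊆ : S ⊆ 𝟎 ∷ rest′
        S⊆ = subst (λ e → S ⊆ e ∷ rest′) e₀≡𝟎 (T₂⊆ ∘ S⊆T₂)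
        length≡ : suc (length rest′) ≡ length S
        length≡ = ≤-antisym (Unique-⊆⇒length≤ (proj₂ trail′) (T₂⊆S ∘ ⊆T₂))
                            (Unique-⊆⇒length≤ (Unique-Preimage (proj₂ trail)) (T₂⊆ ∘ S⊆T₂))

-- Closed trails of every length

module Certificates (p m : ℕ) where

  open Words p
  open Order p m
  open DecSubset _≟E_ using (_⊆?_)
  open DecUnique _≟E_ using (unique?)

  walk? : ∀ u es v → Dec (Walk u es v)
  walk? u []       v = u ≟V v
  walk? u (e ∷ es) v = (tail e ≟V u) ×-dec walk? (init e) es v

  sumWalk : ∀ {rest} s x Z → {True (walk? x Z x)} → {True (Z ⊆? rest)} →
            {True (FinP.all? (λ a → length Z · a Fin.≟ a))} → {True (lastSum Z Fin.≟ s)} → SumWalk rest s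
  sumWalk s x Z {w} {z} {l} {σ} = record
    { start = x ; edges = Z ; closed = toWitness w ; edges⊆rest = toWitness z
    ; length≡1-mod-q = toWitness l ; lastSum≡s = toWitness σ }

  liftable : ∀ rest → {True (walk? 𝟎 (𝟎 ∷ rest) 𝟎)} → {True (unique? (𝟎 ∷ rest))} →
             SumWalk rest 𝟘 → SumWalk rest 𝟙 → Liftable rest
  liftable rest {w} {u} walk₀ walk₁ = record { trail = toWitness w , toWitness u ; walk₀ = walk₀ ; walk₁ = walk₁ }

  closedTrail : ∀ w T → {True (walk? w T w)} → {True (unique? T)} → ClosedTrail w T
  closedTrail w T {c} {u} = toWitness c , toWitness u

module Ternary where
  open Order 1 1
  open Certificates 1 1

  liftable₅ : Liftable ((# 1 ∷ # 0 ∷ []) ∷ (# 0 ∷ # 1 ∷ []) ∷ (# 2 ∷ # 0 ∷ []) ∷ (# 0 ∷ # 2 ∷ []) ∷ [])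
  liftable₅ = liftable _ (sumWalk _ (# 0 ∷ []) ((# 1 ∷ # 0 ∷ []) ∷ (# 0 ∷ # 1 ∷ []) ∷ (# 2 ∷ # 0 ∷ []) ∷ (# 0 ∷ # 2 ∷ []) ∷ [])) (sumWalk _ (# 0 ∷ []) ((# 2 ∷ # 0 ∷ []) ∷ (# 0 ∷ # 2 ∷ []) ∷ (# 2 ∷ # 0 ∷ []) ∷ (# 0 ∷ # 2 ∷ []) ∷ []))

module Quaternary where
  open Order 2 1
  open Certificates 2 1

  liftable₅ : Liftable ((# 3 ∷ # 0 ∷ []) ∷ (# 1 ∷ # 3 ∷ []) ∷ (# 1 ∷ # 1 ∷ []) ∷ (# 0 ∷ # 1 ∷ []) ∷ [])
  liftable₅ = liftable _ (sumWalk _ (# 0 ∷ []) ((# 3 ∷ # 0 ∷ []) ∷ (# 1 ∷ # 3 ∷ []) ∷ (# 0 ∷ # 1 ∷ []) ∷ (# 3 ∷ # 0 ∷ []) ∷ (# 1 ∷ # 3 ∷ []) ∷ (# 0 ∷ # 1 ∷ []) ∷ (# 3 ∷ # 0 ∷ []) ∷ (# 1 ∷ # 3 ∷ []) ∷ (# 0 ∷ # 1 ∷ []) ∷ [])) (sumWalk _ (# 1 ∷ []) ((# 1 ∷ # 1 ∷ []) ∷ []))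

module BinaryOrder3 where
  open Order 0 3
  open Certificates 0 3

  liftable₉ : Liftable ((# 1 ∷ # 0 ∷ # 0 ∷ # 0 ∷ []) ∷ (# 0 ∷ # 1 ∷ # 0 ∷ # 0 ∷ []) ∷ (# 0 ∷ # 0 ∷ # 1 ∷ # 0 ∷ []) ∷ (# 1 ∷ # 0 ∷ # 0 ∷ # 1 ∷ []) ∷ (# 1 ∷ # 1 ∷ # 0 ∷ # 0 ∷ []) ∷ (# 0 ∷ # 1 ∷ # 1 ∷ # 0 ∷ []) ∷ (# 0 ∷ # 0 ∷ # 1 ∷ # 1 ∷ []) ∷ (# 0 ∷ # 0 ∷ # 0 ∷ # 1 ∷ []) ∷ [])
  liftable₉ = liftable _ (sumWalk _ (# 0 ∷ # 0 ∷ # 0 ∷ []) ((# 1 ∷ # 0 ∷ # 0 ∷ # 0 ∷ []) ∷ (# 1 ∷ # 1 ∷ # 0 ∷ # 0 ∷ []) ∷ (# 0 ∷ # 1 ∷ # 1 ∷ # 0 ∷ []) ∷ (# 0 ∷ # 0 ∷ # 1 ∷ # 1 ∷ []) ∷ (# 0 ∷ # 0 ∷ # 0 ∷ # 1 ∷ []) ∷ [])) (sumWalk _ (# 0 ∷ # 0 ∷ # 0 ∷ []) ((# 1 ∷ # 0 ∷ # 0 ∷ # 0 ∷ []) ∷ (# 0 ∷ # 1 ∷ # 0 ∷ # 0 ∷ []) ∷ (# 0 ∷ # 0 ∷ # 1 ∷ # 0 ∷ []) ∷ (# 0 ∷ # 0 ∷ # 0 ∷ # 1 ∷ []) ∷ (#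 1 ∷ # 0 ∷ # 0 ∷ # 0 ∷ []) ∷ (# 1 ∷ # 1 ∷ # 0 ∷ # 0 ∷ []) ∷ (# 0 ∷ # 1 ∷ # 1 ∷ # 0 ∷ []) ∷ (# 0 ∷ # 0 ∷ # 1 ∷ # 1 ∷ []) ∷ (# 0 ∷ # 0 ∷ # 0 ∷ # 1 ∷ []) ∷ []))

  liftable₁₀ : Liftable ((# 1 ∷ # 0 ∷ # 0 ∷ # 0 ∷ []) ∷ (# 0 ∷ # 1 ∷ # 0 ∷ # 0 ∷ []) ∷ (# 0 ∷ # 0 ∷ # 1 ∷ # 0 ∷ []) ∷ (# 1 ∷ # 0 ∷ # 0 ∷ # 1 ∷ []) ∷ (# 1 ∷ # 1 ∷ # 0 ∷ # 0 ∷ []) ∷ (# 1 ∷ # 1 ∷ # 1 ∷ # 0 ∷ []) ∷ (# 0 ∷ # 1 ∷ # 1 ∷ # 1 ∷ []) ∷ (# 0 ∷ # 0 ∷ # 1 ∷ # 1 ∷ []) ∷ (# 0 ∷ # 0 ∷ # 0 ∷ # 1 ∷ []) ∷ [])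
  liftable₁₀ = liftable _ (sumWalk _ (# 0 ∷ # 0 ∷ # 0 ∷ []) ((# 1 ∷ # 0 ∷ # 0 ∷ # 0 ∷ []) ∷ (# 0 ∷ # 1 ∷ # 0 ∷ # 0 ∷ []) ∷ (# 0 ∷ # 0 ∷ # 1 ∷ # 0 ∷ []) ∷ (# 1 ∷ # 0 ∷ # 0 ∷ # 1 ∷ []) ∷ (# 0 ∷ # 1 ∷ # 0 ∷ # 0 ∷ []) ∷ (# 0 ∷ # 0 ∷ # 1 ∷ # 0 ∷ []) ∷ (# 0 ∷ # 0 ∷ # 0 ∷ # 1 ∷ []) ∷ [])) (sumWalk _ (# 0 ∷ # 0 ∷ # 0 ∷ []) ((# 1 ∷ # 0 ∷ # 0 ∷ # 0 ∷ []) ∷ (# 0 ∷ # 1 ∷ # 0 ∷ # 0 ∷ []) ∷ (# 0 ∷ # 0 ∷ # 1 ∷ # 0 ∷ []) ∷ (# 0 ∷ # 0 ∷ # 0 ∷ # 1 ∷ []) ∷ (# 1 ∷ # 0 ∷ # 0 ∷ # 0 ∷ []) ∷ (# 0 ∷ # 1 ∷ # 0 ∷ # 0 ∷ []) ∷ (# 0 ∷ # 0 ∷ # 1 ∷ # 0 ∷ []) ∷ (# 1 ∷ # 0 ∷ # 0 ∷ # 1 ∷ []) ∷ (# 0 ∷ # 1 ∷ # 0 ∷ # 0 ∷ []) ∷ (# 0 ∷ # 0 ∷ # 1 ∷ # 0 ∷ []) ∷ (# 0 ∷ # 0 ∷ # 0 ∷ # 1 ∷ []) ∷ []))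

  liftable₁₁ : Liftable ((# 1 ∷ # 0 ∷ # 0 ∷ # 0 ∷ []) ∷ (# 0 ∷ # 1 ∷ # 0 ∷ # 0 ∷ []) ∷ (# 1 ∷ # 0 ∷ # 1 ∷ # 0 ∷ []) ∷ (# 0 ∷ # 1 ∷ # 0 ∷ # 1 ∷ []) ∷ (# 0 ∷ # 0 ∷ # 1 ∷ # 0 ∷ []) ∷ (# 1 ∷ # 0 ∷ # 0 ∷ # 1 ∷ []) ∷ (# 1 ∷ # 1 ∷ # 0 ∷ # 0 ∷ []) ∷ (# 0 ∷ # 1 ∷ # 1 ∷ # 0 ∷ []) ∷ (# 0 ∷ # 0 ∷ # 1 ∷ # 1 ∷ []) ∷ (# 0 ∷ # 0 ∷ # 0 ∷ # 1 ∷ []) ∷ [])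
  liftable₁₁ = liftable _ (sumWalk _ (# 0 ∷ # 0 ∷ # 0 ∷ []) ((# 1 ∷ # 0 ∷ # 0 ∷ # 0 ∷ []) ∷ (# 1 ∷ # 1 ∷ # 0 ∷ # 0 ∷ []) ∷ (# 0 ∷ # 1 ∷ # 1 ∷ # 0 ∷ []) ∷ (# 0 ∷ # 0 ∷ # 1 ∷ # 1 ∷ []) ∷ (# 0 ∷ # 0 ∷ # 0 ∷ # 1 ∷ []) ∷ [])) (sumWalk _ (# 0 ∷ # 0 ∷ # 0 ∷ []) ((# 1 ∷ # 0 ∷ # 0 ∷ # 0 ∷ []) ∷ (# 0 ∷ # 1 ∷ # 0 ∷ # 0 ∷ []) ∷ (# 0 ∷ # 0 ∷ # 1 ∷ # 0 ∷ []) ∷ (# 0 ∷ # 0 ∷ # 0 ∷ # 1 ∷ []) ∷ (# 1 ∷ # 0 ∷ # 0 ∷ # 0 ∷ []) ∷ (# 1 ∷ # 1 ∷ # 0 ∷ # 0 ∷ []) ∷ (# 0 ∷ # 1 ∷ # 1 ∷ # 0 ∷ []) ∷ (# 0 ∷ # 0 ∷ # 1 ∷ # 1 ∷ []) ∷ (# 0 ∷ # 0 ∷ # 0 ∷ # 1 ∷ []) ∷ []))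

  liftable₁₂ : Liftable ((# 1 ∷ # 0 ∷ # 0 ∷ # 0 ∷ []) ∷ (# 0 ∷ # 1 ∷ # 0 ∷ # 0 ∷ []) ∷ (# 1 ∷ # 0 ∷ # 1 ∷ # 0 ∷ []) ∷ (# 0 ∷ # 1 ∷ # 0 ∷ # 1 ∷ []) ∷ (# 0 ∷ # 0 ∷ # 1 ∷ # 0 ∷ []) ∷ (# 1 ∷ # 0 ∷ # 0 ∷ # 1 ∷ []) ∷ (# 1 ∷ # 1 ∷ # 0 ∷ # 0 ∷ []) ∷ (# 1 ∷ # 1 ∷ # 1 ∷ # 0 ∷ []) ∷ (# 0 ∷ # 1 ∷ # 1 ∷ # 1 ∷ []) ∷ (# 0 ∷ # 0 ∷ # 1 ∷ # 1 ∷ []) ∷ (# 0 ∷ # 0 ∷ # 0 ∷ # 1 ∷ []) ∷ [])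
  liftable₁₂ = liftable _ (sumWalk _ (# 0 ∷ # 0 ∷ # 0 ∷ []) ((# 1 ∷ # 0 ∷ # 0 ∷ # 0 ∷ []) ∷ (# 0 ∷ # 1 ∷ # 0 ∷ # 0 ∷ []) ∷ (# 0 ∷ # 0 ∷ # 1 ∷ # 0 ∷ []) ∷ (# 1 ∷ # 0 ∷ # 0 ∷ # 1 ∷ []) ∷ (# 0 ∷ # 1 ∷ # 0 ∷ # 0 ∷ []) ∷ (# 0 ∷ # 0 ∷ # 1 ∷ # 0 ∷ []) ∷ (# 0 ∷ # 0 ∷ # 0 ∷ # 1 ∷ []) ∷ [])) (sumWalk _ (# 0 ∷ # 0 ∷ # 0 ∷ []) ((# 1 ∷ # 0 ∷ # 0 ∷ # 0 ∷ []) ∷ (# 0 ∷ # 1 ∷ # 0 ∷ # 0 ∷ []) ∷ (# 0 ∷ # 0 ∷ # 1 ∷ # 0 ∷ []) ∷ (# 1 ∷ # 0 ∷ # 0 ∷ # 1 ∷ []) ∷ (# 0 ∷ # 1 ∷ # 0 ∷ # 0 ∷ []) ∷ (# 1 ∷ # 0 ∷ # 1 ∷ # 0 ∷ []) ∷ (# 0 ∷ # 1 ∷ # 0 ∷ # 1 ∷ []) ∷ (# 0 ∷ # 0 ∷ # 1 ∷ # 0 ∷ []) ∷ (# 0 ∷ # 0 ∷ # 0 ∷ # 1 ∷ []) ∷ []))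

module BinaryOrder1 where
  open Order 0 1
  open Certificates 0 1

  trail₃ : ClosedTrail (# 0 ∷ []) ((# 0 ∷ # 0 ∷ []) ∷ (# 1 ∷ # 0 ∷ []) ∷ (# 0 ∷ # 1 ∷ []) ∷ [])
  trail₃ = closedTrail _ _

module BinaryOrder2 where
  open Order 0 2
  open Certificates 0 2

  trail₅ : ClosedTrail (# 0 ∷ # 0 ∷ []) ((# 0 ∷ # 0 ∷ # 0 ∷ []) ∷ (# 1 ∷ # 0 ∷ # 0 ∷ []) ∷ (# 1 ∷ # 1 ∷ # 0 ∷ []) ∷ (# 0 ∷ # 1 ∷ # 1 ∷ []) ∷ (# 0 ∷ # 0 ∷ # 1 ∷ []) ∷ [])
  trail₅ = closedTrail _ _

  trail₆ : ClosedTrail (# 0 ∷ # 0 ∷ []) ((# 0 ∷ # 0 ∷ # 0 ∷ []) ∷ (# 1 ∷ # 0 ∷ # 0 ∷ []) ∷ (# 1 ∷ # 1 ∷ # 0 ∷ []) ∷ (# 1 ∷ # 1 ∷ # 1 ∷ []) ∷ (# 0 ∷ # 1 ∷ # 1 ∷ []) ∷ (# 0 ∷ # 0 ∷ # 1 ∷ []) ∷ [])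
  trail₆ = closedTrail _ _

module OrderZero (p : ℕ) where

  open Words p
  open Order p 0

  letterEdge : Letter → Edge
  letterEdge c = c ∷ []

  walk-any : ∀ es → Walk [] es []
  walk-any []              = refl
  walk-any ((_ ∷ []) ∷ es) = refl , walk-any es

  firstLetters : ℕ → List Edge
  firstLetters k = map letterEdge (take k (allFin q))

  closedTrail-firstLetters : ∀ k → ClosedTrail [] (firstLetters k)
  closedTrail-firstLetters k = walk-any (firstLetters k) , map⁺ (cong head) (take⁺ k (allFin⁺ q))

  length-firstLetters : ∀ k → k ≤ q → length (firstLetters k) ≡ k
  length-firstLetters k k≤q = trans (length-map letterEdge (take k (allFin q)))
    (length-take-≤ k (allFin q) (subst (k ≤_) (sym (length-tabulate {n = q} (λ i → i))) k≤q))

-- The walk of sum 𝟘 below uses the letter 𝟚, so this needs q ≥ 3.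
module OrderZeroLiftable (p′ : ℕ) where

  open Words (suc p′)
  open Order (suc p′) 0
  open OrderZero (suc p′)

  𝟚 : Letter
  𝟚 = Fin.suc (Fin.suc Fin.zero)

  liftable-firstLetters : ∀ k → Liftable (map letterEdge (take (suc (suc k)) (tabulate Fin.suc)))
  liftable-firstLetters k = record
    { trail = closedTrail-firstLetters (3 + k)
    ; walk₀ = record
      { start          = []
      ; edges          = Z
      ; closed         = walk-any Z
      ; edges⊆rest     = λ { (here refl) → here refl ; (there (here refl)) → here refl
                           ; (there (there e∈)) → subst (_∈ _) (sym (∈-replicate⁻ (2 + p′) e∈)) (there (here refl)) }
      ; length≡1-mod-q = λ a → trans (cong (λ n → suc (suc n) · a) (length-replicate (2 + p′))) ([1+q]·x≡x a)
      ; lastSum≡s      = begin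
          𝟙 ⊕ (𝟙 ⊕ lastSum twos)  ≡⟨ ⊕-assoc 𝟙 𝟙 (lastSum twos) ⟨
          (𝟙 ⊕ 𝟙) ⊕ lastSum twos  ≡⟨ cong₂ _⊕_ 𝟙⊕𝟙≡𝟚 (lastSum-replicate (2 + p′) (letterEdge 𝟚)) ⟩
          q · 𝟚                   ≡⟨ q·x≡𝟘 𝟚 ⟩
          𝟘                       ∎
      }
    ; walk₁ = record
      { start = [] ; edges = [ letterEdge 𝟙 ] ; closed = walk-any [ letterEdge 𝟙 ] ; edges⊆rest = λ { (here refl) → here refl }
      ; length≡1-mod-q = ⊕-identityʳ ; lastSum≡s = ⊕-identityʳ 𝟙 }
    }
    where
    open ≡-Reasoning
    𝟙⊕𝟙≡𝟚 : 𝟙 ⊕ 𝟙 ≡ 𝟚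
    𝟙⊕𝟙≡𝟚 = toℕ-injective refl
    twos : List Edge
    twos = replicate (2 + p′) (letterEdge 𝟚)
    Z : List Edge
    Z = letterEdge 𝟙 ∷ letterEdge 𝟙 ∷ twos

module OrderOne (p : ℕ) where

  open Words p
  open Order p 1

  edge : Letter → Letter → Edge
  edge x y = x ∷ y ∷ []

  looped excursion : Letter → List Edge
  looped    i = edge i 𝟘 ∷ edge i i ∷ edge 𝟘 i ∷ []
  excursion i = edge i 𝟘 ∷ edge 𝟘 i ∷ []

  nonzero : List Letter
  nonzero = tabulate Fin.suc

  -- Round trips 0 → i → 0 for the first l + m nonzero letters i, with the loop at i for the first l.
  flower : ℕ → ℕ → List Edge
  flower l m = concatMap looped (take l nonzero) ++ concatMap excursion (take m (drop l nonzero))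

  petal : Edge → Letter
  petal (x ∷ y ∷ []) with x Fin.≟ 𝟘
  ... | yes _ = y
  ... | no  _ = x

  petal-edge-𝟘 : ∀ i → petal (edge i 𝟘) ≡ i
  petal-edge-𝟘 i with i Fin.≟ 𝟘
  ... | yes i≡𝟘 = sym i≡𝟘
  ... | no  _   = refl

  petal-edge-i : ∀ i → petal (edge i i) ≡ i
  petal-edge-i i with i Fin.≟ 𝟘
  ... | yes _ = refl
  ... | no  _ = refl

  petal-looped : ∀ {i z} → z ∈ looped i → petal z ≡ i
  petal-looped {i} (here refl)                 = petal-edge-𝟘 i
  petal-looped {i} (there (here refl))         = petal-edge-i i
  petal-looped     (there (there (here refl))) = refl

  petal-excursion : ∀ {i z} → z ∈ excursion i → petal z ≡ i
  petal-excursion {i} (here refl)         = petal-edge-𝟘 i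
  petal-excursion     (there (here refl)) = refl

  nonzero≢𝟘 : ∀ {i} → i ∈ nonzero → i ≢ 𝟘
  nonzero≢𝟘 i∈ refl with ∈-tabulate⁻ {f = Fin.suc} i∈
  ... | _ , ()

  Unique-nonzero : Unique nonzero
  Unique-nonzero = tabulate⁺ FinP.suc-injective

  Unique-looped : ∀ {i} → i ≢ 𝟘 → Unique (looped i)
  Unique-looped i≢𝟘 =
    ((λ eq → i≢𝟘 (sym (cong (head ∘ tail) eq))) All.∷ (λ eq → i≢𝟘 (cong head eq)) All.∷ All.[]) ∷
    ((λ eq → i≢𝟘 (cong head eq)) All.∷ All.[]) ∷ (All.[] ∷ [])

  Unique-excursion : ∀ {i} → i ≢ 𝟘 → Unique (excursion i)
  Unique-excursion i≢𝟘 = ((λ eq → i≢𝟘 (cong head eq)) All.∷ All.[]) ∷ (All.[] ∷ [])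

  module _ (l m : ℕ) where

    private
      A = take l nonzero
      B = take m (drop l nonzero)

    B⊆nonzero : B ⊆ nonzero
    B⊆nonzero = drop⊆ l nonzero ∘ take⊆ m (drop l nonzero)

    petal∈ : ∀ {z} → z ∈ flower l m → petal z ∈ nonzero
    petal∈ z∈ with ∈-++⁻ (concatMap looped A) z∈
    ... | inj₁ z∈A = let i , i∈ , z∈i = find (∈-concatMap⁻ looped {xs = A} z∈A) in
                     subst (_∈ nonzero) (sym (petal-looped z∈i)) (take⊆ l nonzero i∈)
    ... | inj₂ z∈B = let i , i∈ , z∈i = find (∈-concatMap⁻ excursion {xs = B} z∈B) in
                     subst (_∈ nonzero) (sym (petal-excursion z∈i)) (B⊆nonzero i∈)

    Unique-flower : Unique (𝟎 ∷ flower l m)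
    Unique-flower = AllP.¬Any⇒All¬ (flower l m) (λ 𝟎∈ → nonzero≢𝟘 (petal∈ 𝟎∈) refl) ∷
      ++⁺ (Unique-concatMap⁺ petal petal-looped (λ i∈ → Unique-looped (nonzero≢𝟘 (take⊆ l nonzero i∈))) (take⁺ l Unique-nonzero))
          (Unique-concatMap⁺ petal petal-excursion (λ i∈ → Unique-excursion (nonzero≢𝟘 (B⊆nonzero i∈)))
                             (take⁺ m (drop⁺ l Unique-nonzero)))
          disjoint
      where
      disjoint : ∀ {z} → ¬ (z ∈ concatMap looped A × z ∈ concatMap excursion B)
      disjoint (z∈A , z∈B) =
        let i , i∈A , z∈i = find (∈-concatMap⁻ looped {xs = A} z∈A)
            j , j∈B , z∈j = find (∈-concatMap⁻ excursion {xs = B} z∈B) in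
        Unique-++⇒∉ (subst Unique (sym (take++drop≡id l nonzero)) Unique-nonzero) i∈A
          (subst (_∈ drop l nonzero) (trans (sym (petal-excursion z∈j)) (petal-looped z∈i)) (take⊆ m (drop l nonzero) j∈B))

    walk-flower : Walk 𝟎 (𝟎 ∷ flower l m) 𝟎
    walk-flower = refl , walk-++ (concatMap looped A) (walk-concatMap looped (λ _ → refl , refl , refl , refl) A)
                                                      (walk-concatMap excursion (λ _ → refl , refl , refl) B)

    length-flower : l + m ≤ suc p → length (flower l m) ≡ 3 * l + 2 * m
    length-flower l+m≤ = begin
      length (flower l m)                                            ≡⟨ length-++ (concatMap looped A) ⟩
      length (concatMap looped A) + length (concatMap excursion B)   ≡⟨ cong₂ _+_ (length-concatMap-const 3 (λ _ → refl) A)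
                                                                                  (length-concatMap-const 2 (λ _ → refl) B) ⟩
      3 * length A + 2 * length B
        ≡⟨ cong₂ (λ a b → 3 * a + 2 * b) (length-take-≤ l nonzero l≤) (length-take-≤ m (drop l nonzero) m≤) ⟩
      3 * l + 2 * m                                                  ∎
      where
      open ≡-Reasoning
      |nonzero| : length nonzero ≡ suc p
      |nonzero| = length-tabulate Fin.suc
      l≤ : l ≤ length nonzero
      l≤ = subst (l ≤_) (sym |nonzero|) (≤-trans (m≤m+n l m) l+m≤)
      m≤ : m ≤ length (drop l nonzero)
      m≤ = subst (m ≤_) (sym (trans (length-drop l nonzero) (cong (_∸ l) |nonzero|)))
                 (m+n≤o⇒m≤o∸n m (subst (_≤ suc p) (+-comm l m) l+m≤))

  walk-loops : ∀ n i → Walk (i ∷ []) (replicate n (edge i i)) (i ∷ [])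
  walk-loops zero    i = refl
  walk-loops (suc n) i = refl , walk-loops n i

  liftable-flower : ∀ l m → Liftable (flower (suc l) m)
  liftable-flower l m = record
    { trail = walk-flower (suc l) m , Unique-flower (suc l) m
    ; walk₀ = record
      { start          = 𝟘 ∷ []
      ; edges          = Z
      ; closed         = refl , walk-++ loops (walk-loops (suc p) 𝟙) (refl , refl)
      ; edges⊆rest     = in-flower ∘ Z⊆looped
      ; length≡1-mod-q = λ a → trans (cong (_· a) |Z|) ([1+q]·x≡x a)
      ; lastSum≡s      = begin
          𝟘 ⊕ lastSum (loops ++ [ edge 𝟘 𝟙 ])   ≡⟨ ⊕-identityˡ _ ⟩
          lastSum (loops ++ [ edge 𝟘 𝟙 ])       ≡⟨ lastSum-++ loops [ edge 𝟘 𝟙 ] ⟩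
          lastSum loops ⊕ (𝟙 ⊕ 𝟘)               ≡⟨ cong₂ _⊕_ (lastSum-replicate (suc p) (edge 𝟙 𝟙)) (⊕-identityʳ 𝟙) ⟩
          suc p · 𝟙 ⊕ 𝟙                         ≡⟨ ⊕-comm (suc p · 𝟙) 𝟙 ⟩
          q · 𝟙                                 ≡⟨ q·x≡𝟘 𝟙 ⟩
          𝟘                                     ∎
      }
    ; walk₁ = record
      { start = 𝟙 ∷ [] ; edges = [ edge 𝟙 𝟙 ] ; closed = refl , refl
      ; edges⊆rest = λ { (here refl) → in-flower (there (here refl)) }
      ; length≡1-mod-q = ⊕-identityʳ ; lastSum≡s = ⊕-identityʳ 𝟙 }
    }
    where
    open ≡-Reasoning
    loops : List Edge
    loops = replicate (suc p) (edge 𝟙 𝟙)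
    Z : List Edge
    Z = edge 𝟙 𝟘 ∷ loops ++ [ edge 𝟘 𝟙 ]
    |Z| : length Z ≡ suc q
    |Z| = cong suc (trans (length-++ loops) (trans (cong (_+ 1) (length-replicate (suc p))) (+-comm (suc p) 1)))
    in-flower : looped 𝟙 ⊆ flower (suc l) m
    in-flower = ∈-++⁺ˡ {ys = concatMap excursion (take m (drop (suc l) nonzero))}
              ∘ ∈-++⁺ˡ {ys = concatMap looped (take l (tabulate (Fin.suc ∘ Fin.suc)))}
    Z⊆looped : Z ⊆ looped 𝟙
    Z⊆looped (here refl) = here refl
    Z⊆looped (there e∈) with ∈-++⁻ loops e∈
    ... | inj₁ e∈loops    = subst (_∈ looped 𝟙) (sym (∈-replicate⁻ (suc p) e∈loops)) (there (here refl))
    ... | inj₂ (here refl) = there (there (here refl))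

ceil-div : ∀ q → 1 ≤ q → ∀ k → ∃ λ j → ∃ λ r → q * j ≡ k + r × r < q
ceil-div q 1≤q zero = 0 , 0 , *-zeroʳ q , 1≤q
ceil-div q@(suc q′) 1≤q (suc k) with ceil-div q 1≤q k
... | j , zero  , e , _   = suc j , q′ , trans (*-suc q j) (trans (cong (q +_) (trans e (+-identityʳ k))) (cong suc (+-comm q′ k))) , ≤-refl
... | j , suc r , e , r<q = j , r , trans e (+-suc k r) , <⇒≤ r<q

ceil-div-bounds : ∀ {q j k r A B} → q * j ≡ k + r → r < q → q * A < k → k ≤ q * B → A < j × j ≤ B
ceil-div-bounds {q} {j} {k} {r} {A} {B} e r<q lo hi =
  *-cancelˡ-< q A j (≤-trans lo (subst (k ≤_) (sym e) (m≤m+n k r))) ,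
  ≤-pred (*-cancelˡ-< q j (suc B) (begin-strict
    q * j        ≡⟨ e ⟩
    k + r        <⟨ +-monoʳ-< k r<q ⟩
    k + q        ≤⟨ +-monoˡ-≤ q hi ⟩
    q * B + q    ≡⟨ +-comm (q * B) q ⟩
    q + q * B    ≡⟨ *-suc q B ⟨
    q * suc B    ∎))
  where open ≤-Reasoning

parity : ∀ k → ∃ λ h → k ≡ h + h ⊎ k ≡ suc (h + h)
parity zero = 0 , inj₁ refl
parity (suc k) with parity k
... | h , inj₁ e = h , inj₂ (cong suc e)
... | h , inj₂ e = suc h , inj₁ (trans (cong suc e) (cong suc (sym (+-suc h h))))

module Pancyclic (p : ℕ) where

  open Words p

  ClosedTrailOfLength : ℕ → ℕ → Set
  ClosedTrailOfLength m k = ∃ λ T → ∃ λ w → Order.ClosedTrail p m w T × length T ≡ k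

  LiftableOfLength : ℕ → ℕ → Set
  LiftableOfLength m k = ∃ λ rest → Order.Liftable p m rest × suc (length rest) ≡ k

  liftable⇒closedTrail : ∀ {m k} → LiftableOfLength m k → ClosedTrailOfLength m k
  liftable⇒closedTrail (rest , L , len) = _ , _ , Order.Liftable.trail L , len

  liftAcross : ∀ {m A B} → (∀ {j} → A < j → j ≤ B → LiftableOfLength m j) →
               ∀ {k} → q * A < k → k ≤ q * B → LiftableOfLength (suc m) k
  liftAcross {m} {A} {B} lift {k} lo hi = lifted (ceil-div q (s≤s z≤n) k)
    where
    lifted : (∃ λ j → ∃ λ r → q * j ≡ k + r × r < q) → LiftableOfLength (suc m) k
    lifted (j , r , e , r<q) =
      let A<j , j≤B = ceil-div-bounds e r<q lo hi
          rest , L , len = lift {j} A<j j≤B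
          rest′ , L′ , len′ = Integration.Lift.liftLiftable p m r r<q L
      in rest′ , L′ , +-cancelʳ-≡ r (suc (length rest′)) k (trans len′ (trans (cong (q *_) len) e))

  closedTrail-lineLift : ∀ {m k} → 1 ≤ k → ClosedTrailOfLength m k → ClosedTrailOfLength (suc m) k
  closedTrail-lineLift 1≤k ([]     , _ , _     , refl) = ⊥-elim (<⇒≱ 1≤k z≤n)
  closedTrail-lineLift 1≤k (_ ∷ _ , _ , trail , len) =
    let T′ , w′ , trail′ , len′ = LineGraph.closedTrail-lineLift p _ trail in T′ , w′ , trail′ , trans len′ len

half≤ : ∀ {h n} → h + h ≤ n + n → h ≤ n
half≤ {h} {n} le with h ≤? n
... | yes h≤n = h≤n
... | no  h≰n = ⊥-elim (<⇒≱ (+-mono-< (≰⇒> h≰n) (≰⇒> h≰n)) le)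

half< : ∀ {h n} → suc (h + h) ≤ n + n → h < n
half< {h} {n} lt with suc h ≤? n
... | yes h<n = h<n
... | no  h≮n = ⊥-elim (<⇒≱ lt (+-mono-≤ (≮⇒≥ h≮n) (≮⇒≥ h≮n)))

module Pancyclic≥3 (p′ : ℕ) where

  open Pancyclic (suc p′)
  open Words (suc p′)
  open OrderZero (suc p′)

  liftable-order0 : ∀ {j} → 2 < j → j ≤ q → LiftableOfLength 0 j
  liftable-order0 {suc (suc (suc k))} (s≤s (s≤s (s≤s z≤n))) j≤q =
    _ , OrderZeroLiftable.liftable-firstLetters p′ k , length-firstLetters (3 + k) j≤q

  -- Flowers have odd length at least 7 or even length; length 5 is needed only for q = 3, 4.
  liftable-order1-short : ∀ {k} → q < k → k ≤ q + q → LiftableOfLength 1 k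
  liftable-order1-short {k} lo hi with parity k
  ... | suc (suc h) , inj₁ refl =
    _ , OrderOne.liftable-flower (suc p′) 0 h , trans (cong suc (OrderOne.length-flower (suc p′) 1 h 1+h≤)) (even h)
    where
    1+h≤ : 1 + h ≤ suc (suc p′)
    1+h≤ = ≤-pred (half≤ hi)
    even : ∀ h → suc (3 * 1 + 2 * h) ≡ suc (suc h) + suc (suc h)
    even = solve-∀
  ... | suc (suc (suc h)) , inj₂ refl =
    _ , OrderOne.liftable-flower (suc p′) 1 h , trans (cong suc (OrderOne.length-flower (suc p′) 2 h 2+h≤)) (odd h)
    where
    2+h≤ : 2 + h ≤ suc (suc p′)
    2+h≤ = ≤-trans (n≤1+n _) (≤-pred (half< hi))
    odd : ∀ h → suc (3 * 2 + 2 * h) ≡ suc (suc (suc (suc h)) + suc (suc (suc h)))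
    odd = solve-∀
  ... | 2 , inj₂ refl = five p′ lo
    where
    five : ∀ p′ → 3 + p′ < 5 → Pancyclic.LiftableOfLength (suc p′) 1 5
    five zero              _ = _ , Ternary.liftable₅ , refl
    five (suc zero)        _ = _ , Quaternary.liftable₅ , refl
    five (suc (suc _)) (s≤s (s≤s (s≤s (s≤s (s≤s ())))))
  ... | zero     , inj₁ refl = ⊥-elim (<⇒≱ lo z≤n)
  ... | zero     , inj₂ refl = ⊥-elim (<⇒≱ lo (s≤s z≤n))
  ... | 1        , inj₁ refl = ⊥-elim (<⇒≱ lo (s≤s (s≤s z≤n)))
  ... | 1        , inj₂ refl = ⊥-elim (<⇒≱ lo (s≤s (s≤s (s≤s z≤n))))

  liftable-order1 : ∀ {k} → q < k → k ≤ q * q → LiftableOfLength 1 k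
  liftable-order1 {k} lo hi with k ≤? q + q
  ... | yes k≤2q = liftable-order1-short lo k≤2q
  ... | no  k≰2q = liftAcross liftable-order0 (subst (_< k) (trans (cong (q +_) (sym (+-identityʳ q))) (*-comm 2 q)) (≰⇒> k≰2q)) hi

  liftable-high : ∀ m {k} → q ^ suc m < k → k ≤ q ^ suc (suc m) → LiftableOfLength (suc m) k
  liftable-high zero    {k} lo hi = liftable-order1 (subst (_< k) (*-identityʳ q) lo) (subst (λ x → k ≤ q * x) (*-identityʳ q) hi)
  liftable-high (suc m)     lo hi = liftAcross (liftable-high m) lo hi

-- For q = 2 there is no liftable trail of order zero, nor of length 5 or 6 of order two; explicit trails
-- take their place.
module Pancyclic₂ where

  open Pancyclic 0

  liftable-order1 : LiftableOfLength 1 4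
  liftable-order1 = _ , OrderOne.liftable-flower 0 0 0 , refl

  liftable-order2 : ∀ {k} → 6 < k → k ≤ 8 → LiftableOfLength 2 k
  liftable-order2 = liftAcross {A = 3} {B = 4} λ 3<j j≤4 → subst (LiftableOfLength 1) (≤-antisym 3<j j≤4) liftable-order1

  liftable-order3 : ∀ {k} → 8 < k → k ≤ 16 → LiftableOfLength 3 k
  liftable-order3 {k} lo hi with k ≤? 12 | m≤n⇒∃[o]m+o≡n lo
  ... | yes _ | 0 , refl = _ , BinaryOrder3.liftable₉  , refl
  ... | yes _ | 1 , refl = _ , BinaryOrder3.liftable₁₀ , refl
  ... | yes _ | 2 , refl = _ , BinaryOrder3.liftable₁₁ , refl
  ... | yes _ | 3 , refl = _ , BinaryOrder3.liftable₁₂ , refl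
  ... | yes k≤12 | suc (suc (suc (suc d))) , refl = ⊥-elim (<⇒≱ (s≤s (m≤m+n 12 d)) k≤12)
  ... | no  k≰12 | _ = liftAcross {A = 6} {B = 8} liftable-order2 (≰⇒> k≰12) hi

  liftable-high : ∀ m {k} → 2 ^ (3 + m) < k → k ≤ 2 ^ (4 + m) → LiftableOfLength (3 + m) k
  liftable-high zero    lo hi = liftable-order3 lo hi
  liftable-high (suc m) lo hi = liftAcross (liftable-high m) lo hi

longClosedTrail : ∀ p m {k} → suc (suc p) ^ suc m < k → k ≤ suc (suc p) ^ suc (suc m) → Pancyclic.ClosedTrailOfLength p (suc m) k
longClosedTrail (suc p′) m lo hi = Pancyclic.liftable⇒closedTrail (suc p′) (Pancyclic≥3.liftable-high p′ m lo hi)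
longClosedTrail zero zero {k} lo hi with m≤n⇒∃[o]m+o≡n lo
... | 0 , refl = _ , _ , BinaryOrder1.trail₃ , refl
... | 1 , refl = Pancyclic.liftable⇒closedTrail 0 Pancyclic₂.liftable-order1
... | suc (suc d) , refl = ⊥-elim (<⇒≱ (s≤s (m≤m+n 4 d)) hi)
longClosedTrail zero (suc zero) {k} lo hi with m≤n⇒∃[o]m+o≡n lo
... | 0 , refl = _ , _ , BinaryOrder2.trail₅ , refl
... | 1 , refl = _ , _ , BinaryOrder2.trail₆ , refl
... | suc (suc d) , refl = Pancyclic.liftable⇒closedTrail 0 (Pancyclic₂.liftable-order2 (s≤s (m≤m+n 6 d)) hi)
longClosedTrail zero (suc (suc m)) lo hi = Pancyclic.liftable⇒closedTrail 0 (Pancyclic₂.liftable-high m lo hi)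

closedTrail : ∀ p m {k} → 1 ≤ k → k ≤ suc (suc p) ^ suc m → Pancyclic.ClosedTrailOfLength p m k
closedTrail p zero {k} 1≤k hi =
  firstLetters k , [] , closedTrail-firstLetters k , length-firstLetters k (subst (k ≤_) (*-identityʳ (suc (suc p))) hi)
  where open OrderZero p
closedTrail p (suc m) {k} 1≤k hi with k ≤? suc (suc p) ^ suc m
... | yes k≤ = Pancyclic.closedTrail-lineLift p 1≤k (closedTrail p m 1≤k k≤)
... | no  k≰ = longClosedTrail p m (≰⇒> k≰) hi

proposition4 : (q n : ℕ) → 2 ≤ q → 1 ≤ n → (k : ℕ) → 1 ≤ k → k ≤ q ^ n →
  ∃ λ (F : AutomataNetwork q n) → AlmostDegree1 F × LongestLimitCycleLength F k
proposition4 zero          _       ()          _  _ _   _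
proposition4 (suc zero)    _       (s≤s ())    _  _ _   _
proposition4 (suc (suc p)) zero    _           () _ _   _
proposition4 (suc (suc p)) (suc m) _           _  k 1≤k k≤qⁿ with closedTrail p m 1≤k k≤qⁿ
... | []    , _ , _     , refl = ⊥-elim (<⇒≱ 1≤k z≤n)
... | _ ∷ _ , _ , trail , refl = network , almostDegree1 , longest
  where open ShiftRegister.FromClosedTrail p m trail
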